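{- Let $\beta=(\beta_L)_{L\in\mathbb{N}}$ be a sequence of integers with $\beta_L\ge 2$ for all $L$, and let $k\ge 1$. Let $\mathcal{C}\subseteq \mathbb{N}^k\setminus\{(0,\dots,0)\}$ be such that the subtraction game $\Gamma(\mathcal{P}_{\mathrm{mis}},\mathcal{C})$, where $\mathcal{P}_{\mathrm{mis}}=\mathbb{N}^k\setminus\{(0,\dots,0)\}$, is $\beta$-saturated (i.e. its Sprague–Grundy function coincides with that of $\Gamma(\mathcal{P}_{\mathrm{mis}},\mathcal{C}_{\mathrm{ord}}^{\beta})$). Then for every $X=(x^0,\dots,x^{k-1})\in\mathcal{P}_{\mathrm{mis}}$, $$\mathrm{sg}(X)=\varphi^{\beta}(X):=\big(x^0\oplus x^1\oplus\cdots\oplus x^{k-1}\big)\oplus\big(B_{\mathrm{mord}_\beta(X)+1}-1\big).$$ In particular, the Sprague–Grundy function of $\Gamma(\mathcal{P}_{\mathrm{mis}},\mathcal{C}_{\mathrm{ord}}^{\beta})$ equals $\varphi^\beta$.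
   Context: $\mathbb{N}$ denotes the nonnegative integers. Put $B_L=\beta_0\beta_1\cdots\beta_{L-1}$ (so $B_0=1$). Every $n\in\mathbb{N}$ has a unique mixed-radix expansion $n=\sum_{L} n_L B_L$ with digits $n_L\in\{0,\dots,\beta_L-1\}$. For $a,b\in\mathbb{N}$, $a\oplus b$ is the nonnegative integer whose $L$-th digit is $(a_L+b_L)\bmod \beta_L$ (digitwise addition without carry). For $n\in\mathbb{N}$, $\mathrm{ord}_\beta(n)=\min\{L: n_L\neq 0\}$ if $n\ne 0$ and $\mathrm{ord}_\beta(0)=\infty$. For $C=(c^0,\dots,c^{k-1})\in\mathbb{N}^k$, $\mathrm{mord}_\beta(C)=\min_i \mathrm{ord}_\beta(c^i)$. Define $\mathcal{C}_{\mathrm{ord}}^\beta=\{C\in\mathbb{N}^k\setminus\{0\}: \mathrm{ord}_\beta(\sum_i c^i)=\mathrm{mord}_\beta(C)\}$. For $\mathcal{P}\subseteq\mathbb{N}^k$ and $\mathcal{C}\subseteq\mathbb{N}^k\setminus\{0\}$, the subtraction game $\Gamma(\mathcal{P},\mathcal{C})$ is the digraph on vertex set $\mathcal{P}$ with an edge $X\to Y$ (i.e. $Y$ is an option of $X$) iff $X,Y\in\mathcal{P}$ and $X-Y\in\mathcal{C}$. Its Sprague–Grundy function is defined recursively by $\mathrm{sg}(X)=\mathrm{mex}\{\mathrm{sg}(Y): Y \text{ an option of } X\}$, where $\mathrm{mex}\,S=\min(\mathbb{N}\setminus S)$. $\Gamma(\mathcal{P},\mathcal{C})$ is called $\beta$-saturated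 if its Sprague–Grundy function equals that of $\Gamma(\mathcal{P},\mathcal{C}_{\mathrm{ord}}^\beta)$. -}

module Defs where

open import Data.Nat using (ℕ; zero; suc; _+_; _*_; _∸_; _/_; _%_; _≤_; _<_)
open import Data.Nat.Base using (_≡ᵇ_)
open import Data.Bool using (true; false)
open import Data.Maybe using (Maybe; just; nothing)
open import Data.Fin using (Fin)
import Data.Fin as F
open import Data.Product using (Σ; _×_; ∃)
open import Relation.Binary.PropositionalEquality using (_≡_; _≢_)
open import Relation.Nullary using (¬_)

-- Division / remainder by a natural number; the value for divisor 0 is an
-- arbitrary convention (never used since all bases β_L ≥ 2, so B_L ≥ 1).
divN : ℕ → ℕ → ℕ
divN n zero    = 0
divN n (suc m) = n / suc m

modN : ℕ → ℕ → ℕ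
modN n zero    = n
modN n (suc m) = n % suc m

B : (ℕ → ℕ) → ℕ → ℕ
B β zero    = 1
B β (suc L) = B β L * β L

digit : (ℕ → ℕ) → ℕ → ℕ → ℕ
digit β L n = modN (divN n (B β L)) (β L)

sumBelow : ℕ → (ℕ → ℕ) → ℕ
sumBelow zero    f = 0
sumBelow (suc N) f = sumBelow N f + f N

-- a ⊕ b = Σ_L ((a_L + b_L) mod β_L) B_L.  All digits of index L ≥ a + b + 1
-- vanish (B_L ≥ 2^L > a + b), so the sum is truncated at L < a + b + 1.
_⊕[_]_ : ℕ → (ℕ → ℕ) → ℕ → ℕ
a ⊕[ β ] b =
  sumBelow (suc (a + b)) (λ L → modN (digit β L a + digit β L b) (β L) * B β L)

-- ord_β n : first L < bound with nonzero digit; nothing = ∞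
ordFrom : (ℕ → ℕ) → ℕ → ℕ → ℕ → Maybe ℕ
ordFrom β n L zero = nothing
ordFrom β n L (suc fuel) with digit β L n ≡ᵇ 0
... | true  = ordFrom β n (suc L) fuel
... | false = just L

-- For n ≠ 0 some digit of index L ≤ n is nonzero, so searching L ≤ n suffices.
ord : (ℕ → ℕ) → ℕ → Maybe ℕ
ord β n = ordFrom β n 0 (suc n)

minω : Maybe ℕ → Maybe ℕ → Maybe ℕ
minω nothing  y        = y
minω (just x) nothing  = just x
minω (just x) (just y) = just (Data.Nat._⊓_ x y)

foldFin : ∀ {A : Set} (k : ℕ) → (A → A → A) → A → (Fin k → A) → A
foldFin zero    op e X = e
foldFin (suc k) op e X = op (X F.zero) (foldFin k op e (λ i → X (F.suc i)))

mord : (ℕ → ℕ) → (k : ℕ) → (Fin k → ℕ) → Maybe ℕ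
mord β k C = foldFin k minω nothing (λ i → ord β (C i))

sumVec : (k : ℕ) → (Fin k → ℕ) → ℕ
sumVec k C = foldFin k _+_ 0 C

NonZeroV : (k : ℕ) → (Fin k → ℕ) → Set
NonZeroV k X = ¬ (∀ i → X i ≡ 0)

Pmis : (k : ℕ) → (Fin k → ℕ) → Set
Pmis k X = NonZeroV k X

Cord : (ℕ → ℕ) → (k : ℕ) → (Fin k → ℕ) → Set
Cord β k C = NonZeroV k C × (ord β (sumVec k C) ≡ mord β k C)

Option : (k : ℕ) → ((Fin k → ℕ) → Set) → ((Fin k → ℕ) → Set)
       → (Fin k → ℕ) → (Fin k → ℕ) → Set
Option k P C X Y = P X × P Y × (∀ i → Y i ≤ X i) × C (λ i → X i ∸ Y i)

IsSG : (k : ℕ) → ((Fin k → ℕ) → Set) → ((Fin k → ℕ) → Set)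
     → ((Fin k → ℕ) → ℕ) → Set
IsSG k P C g =
  ∀ X → P X →
    (∀ Y → Option k P C X Y → g Y ≢ g X)
    × (∀ m → m < g X → Σ (Fin k → ℕ) λ Y → Option k P C X Y × g Y ≡ m)

Saturated : (ℕ → ℕ) → (k : ℕ) → ((Fin k → ℕ) → Set) → ((Fin k → ℕ) → Set) → Set
Saturated β k P C =
  ∀ g h → IsSG k P C g → IsSG k P (Cord β k) h → ∀ X → P X → g X ≡ h X

mordℕ : (ℕ → ℕ) → (k : ℕ) → (Fin k → ℕ) → ℕ
mordℕ β k X with mord β k X
... | just m  = m
... | nothing = 0   -- only happens for X = 0, outside P_mis

φ : (ℕ → ℕ) → (k : ℕ) → (Fin k → ℕ) → ℕ
φ β k X = foldFin k (λ a b → a ⊕[ β ] b) 0 X ⊕[ β ] (B β (suc (mordℕ β k X)) ∸ 1)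

module Submission where

open import Defs
open import Data.Nat
open import Data.Nat.Properties
open import Data.Nat.DivMod
open import Data.Nat.Divisibility using (divides)
open import Data.Nat.Tactic.RingSolver using (solve-∀)
open import Data.Fin using (Fin) renaming (zero to fz; suc to fs)
import Data.Fin.Properties as FinP
open import Data.Vec.Functional using (updateAt)
open import Data.Vec.Functional.Properties using (updateAt-updates; updateAt-minimal)
open import Data.Product
open import Data.Sum
open import Data.Maybe using (Maybe; just; nothing)
open import Data.Maybe.Properties using (just-injective)
open import Data.Empty
open import Data.Bool using (true; false; T)
open import Function using (_∘_; const)
open import Relation.Nullary
open import Relation.Nullary.Decidable using (decidable-stable)
open import Relation.Binary.PropositionalEquality
open import Relation.Binary.Definitions using (Tri; tri<; tri≈; tri>)

-- Saturation says that the Sprague–Grundy function of Γ(P_mis, C)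
-- equals that of Γ(P_mis, C_ord^β), so it suffices to show that φ^β satisfies
-- the Sprague–Grundy recursion of Γ(P_mis, C_ord^β) (`φ-isSG`):
--   (1) no C_ord^β-move preserves φ (`φ-changes`);
--   (2) every v < φ(X) is the φ-value of some option of X (`φ-reaches`).
-- Everything is a digit computation.  With s_L(X) = Σ_i x^i_L and m = mord X,
-- the L-th digit of φ(X) is (s_L + β_L − 1) mod β_L for L ≤ m and s_L mod β_L
-- for L > m (`φ-digit-≤`, `φ-digit->`).  For (1): a move with t = mord C =
-- ord(ΣC) leaves the digits below t unchanged and shifts s_t by a nonzero
-- residue, so digit t of φ changes.  For (2): let t be the highest digit where
-- v and φ(X) differ; lowering the position-ℓ digits of X (ℓ = max(t, mord X))
-- and rewriting the low part of one coordinate produces the option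
-- (module `Construction`).

divN≡/ : ∀ a n .{{_ : NonZero n}} → divN a n ≡ a / n
divN≡/ a (suc n) = refl

modN≡% : ∀ a n .{{_ : NonZero n}} → modN a n ≡ a % n
modN≡% a (suc n) = refl

0%n≡0 : ∀ n .{{_ : NonZero n}} → 0 % n ≡ 0
0%n≡0 (suc n) = refl

pred<self : ∀ n → 0 < n → n ∸ 1 < n
pred<self (suc n) _ = n<1+n n

+-*-/ : ∀ a b Q .{{_ : NonZero b}} → (a + b * Q) / b ≡ a / b + Q
+-*-/ a b Q = trans (+-distrib-/-∣ʳ a (divides Q (*-comm b Q)))
                    (cong (a / b +_) (trans (cong (_/ b) (*-comm b Q)) (m*n/n≡m Q b)))

+-*-/-small : ∀ a b Q .{{_ : NonZero b}} → a < b → (a + b * Q) / b ≡ Q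
+-*-/-small a b Q a<b = trans (+-*-/ a b Q) (cong (_+ Q) (m<n⇒m/n≡0 a<b))

%-absorbˡ : ∀ a b n .{{_ : NonZero n}} → (a % n + b) % n ≡ (a + b) % n
%-absorbˡ a b n = trans (%-distribˡ-+ (a % n) b n)
  (trans (cong (λ z → (z + b % n) % n) (m%n%n≡m%n a n)) (sym (%-distribˡ-+ a b n)))

%-absorbʳ : ∀ a b n .{{_ : NonZero n}} → (a + b % n) % n ≡ (a + b) % n
%-absorbʳ a b n = trans (cong (_% n) (+-comm a (b % n)))
  (trans (%-absorbˡ b a n) (cong (_% n) (+-comm b a)))

+-multiple-% : ∀ a k n .{{_ : NonZero n}} → (a + n * k) % n ≡ a % n
+-multiple-% a k n = trans (cong (λ z → (a + z) % n) (*-comm n k)) ([m+kn]%n≡m%n a k n)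

digit-residue : ∀ n .{{_ : NonZero n}} x q → x < n → (x + n * q) % n ≡ x
digit-residue n x q lt = trans (+-multiple-% x q n) (m<n⇒m%n≡m lt)

%-cancelˡ : ∀ x d n .{{_ : NonZero n}} → (x + d) % n ≡ x % n → d % n ≡ 0
%-cancelˡ x d n eq with x % n + d % n <? n
... | yes lt = +-cancelˡ-≡ (x % n) (d % n) 0
                 (trans (trans (sym (m<n⇒m%n≡m lt)) reduced) (sym (+-identityʳ (x % n))))
  where reduced : (x % n + d % n) % n ≡ x % n
        reduced = trans (%-absorbˡ x (d % n) n) (trans (%-absorbʳ x d n) eq)
... | no nlt = ⊥-elim (<-irrefl e≡n (m%n<n d n))
  where
    r e : ℕ
    r = x % n
    e = d % n
    reduced : (r + e) % n ≡ r
    reduced = trans (%-absorbˡ x e n) (trans (%-absorbʳ x d n) eq)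
    n≤r+e : n ≤ r + e
    n≤r+e = ≮⇒≥ nlt
    overflow<n : r + e ∸ n < n
    overflow<n = +-cancelʳ-< _ _ n
      (subst (_< n + n) (sym (m∸n+n≡m n≤r+e)) (+-mono-< (m%n<n x n) (m%n<n d n)))
    overflow : (r + e) % n ≡ r + e ∸ n
    overflow = trans (cong (_% n) (sym (m∸n+n≡m n≤r+e)))
                     (trans ([m+n]%n≡m%n (r + e ∸ n) n) (m<n⇒m%n≡m overflow<n))
    e≡n : e ≡ n
    e≡n = +-cancelˡ-≡ r e n (trans (sym (m∸n+n≡m n≤r+e)) (cong (_+ n) (trans (sym overflow) reduced)))

-- For S ≥ 1 the number (S + (n − 1)) mod n is the residue of S − 1: it is
-- below S, and S mod n is either 0 or one more than it.
predResidue : ∀ n .{{_ : NonZero n}} S → 1 ≤ S →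
  ((S + (n ∸ 1)) % n < S) × ((S % n ≡ 0) ⊎ (S % n ≡ suc ((S + (n ∸ 1)) % n)))
predResidue n S S≥1 with S % n in S%n
... | zero = subst (_< S) (sym ρ≡n-1) (<-≤-trans (pred<self n n>0) n≤S) , inj₁ refl
  where
    n>0 : 0 < n
    n>0 = >-nonZero⁻¹ n
    ρ≡n-1 : (S + (n ∸ 1)) % n ≡ n ∸ 1
    ρ≡n-1 = trans (sym (%-absorbˡ S (n ∸ 1) n))
      (trans (cong (λ z → (z + (n ∸ 1)) % n) S%n) (m<n⇒m%n≡m (pred<self n n>0)))
    n≤S : n ≤ S
    n≤S with n ≤? S
    ... | yes p = p
    ... | no np = ⊥-elim (<-irrefl (sym (trans (sym (m<n⇒m%n≡m (≰⇒> np))) S%n)) S≥1)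
... | suc s = subst (_< S) (sym ρ≡s) s<S , inj₂ (cong suc (sym ρ≡s))
  where
    s<n : s < n
    s<n = <-trans (n<1+n s) (subst (_< n) S%n (m%n<n S n))
    ρ≡s : (S + (n ∸ 1)) % n ≡ s
    ρ≡s = trans (sym (%-absorbˡ S (n ∸ 1) n)) (trans (cong (λ z → (z + (n ∸ 1)) % n) S%n)
      (trans (cong (_% n) (trans (sym (+-suc s (n ∸ 1))) (cong (s +_) (m+[n∸m]≡n (>-nonZero⁻¹ n)))))
        (trans ([m+n]%n≡m%n s n) (m<n⇒m%n≡m s<n))))
    s<S : s < S
    s<S = <-≤-trans (n<1+n s) (subst (_≤ S) S%n (m%n≤m S n))

below-predResidue : ∀ n .{{_ : NonZero n}} S x → 1 ≤ S → x < (S + (n ∸ 1)) % n →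
  (x < S) × (suc x < n) × (suc x ≤ S) × (suc x ≢ S % n)
below-predResidue n S x S≥1 lt =
  <-trans lt ρ<S , ≤-<-trans lt (m%n<n _ n) , ≤-trans lt (<⇒≤ ρ<S) , differs (proj₂ (predResidue n S S≥1))
  where
    ρ<S : (S + (n ∸ 1)) % n < S
    ρ<S = proj₁ (predResidue n S S≥1)
    differs : (S % n ≡ 0) ⊎ (S % n ≡ suc ((S + (n ∸ 1)) % n)) → suc x ≢ S % n
    differs (inj₁ z) e with trans e z
    ... | ()
    differs (inj₂ z) e = <-irrefl (suc-injective (trans e z)) lt

suc-<-if-≢pred : ∀ a n → a < n → a ≢ n ∸ 1 → suc a < n
suc-<-if-≢pred a n lt ne with m≤n⇒m<n∨m≡n lt
... | inj₁ p = p
... | inj₂ refl = ⊥-elim (ne refl)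

sumBelow-cong : ∀ N (f g : ℕ → ℕ) → (∀ L → L < N → f L ≡ g L) → sumBelow N f ≡ sumBelow N g
sumBelow-cong zero f g h = refl
sumBelow-cong (suc N) f g h =
  cong₂ _+_ (sumBelow-cong N f g (λ L lt → h L (m<n⇒m<1+n lt))) (h N ≤-refl)

sumBelow-zero : ∀ N (f : ℕ → ℕ) → (∀ L → L < N → f L ≡ 0) → sumBelow N f ≡ 0
sumBelow-zero zero f h = refl
sumBelow-zero (suc N) f h =
  cong₂ _+_ (sumBelow-zero N f (λ L lt → h L (m<n⇒m<1+n lt))) (h N ≤-refl)

sumVec-cong : ∀ k (f g : Fin k → ℕ) → (∀ i → f i ≡ g i) → sumVec k f ≡ sumVec k g
sumVec-cong zero f g h = refl
sumVec-cong (suc k) f g h = cong₂ _+_ (h fz) (sumVec-cong k (f ∘ fs) (g ∘ fs) (h ∘ fs))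

sumVec-zero : ∀ k (f : Fin k → ℕ) → (∀ i → f i ≡ 0) → sumVec k f ≡ 0
sumVec-zero zero f h = refl
sumVec-zero (suc k) f h = cong₂ _+_ (h fz) (sumVec-zero k (f ∘ fs) (h ∘ fs))

sumVec-*ˡ : ∀ k b (f : Fin k → ℕ) → sumVec k (λ i → b * f i) ≡ b * sumVec k f
sumVec-*ˡ zero b f = sym (*-zeroʳ b)
sumVec-*ˡ (suc k) b f =
  trans (cong (b * f fz +_) (sumVec-*ˡ k b (f ∘ fs))) (sym (*-distribˡ-+ b (f fz) _))

sumVec-+ : ∀ k (f g : Fin k → ℕ) → sumVec k (λ i → f i + g i) ≡ sumVec k f + sumVec k g
sumVec-+ zero f g = refl
sumVec-+ (suc k) f g =
  trans (cong (f fz + g fz +_) (sumVec-+ k (f ∘ fs) (g ∘ fs))) (+-interchange (f fz) _ _ _)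
  where +-interchange : ∀ a b c d → a + b + (c + d) ≡ a + c + (b + d)
        +-interchange = solve-∀

sumVec-% : ∀ k (f : Fin k → ℕ) n .{{_ : NonZero n}} →
           sumVec k (λ i → f i % n) % n ≡ sumVec k f % n
sumVec-% zero f n = refl
sumVec-% (suc k) f n = begin
    (f fz % n + sumVec k (λ i → f (fs i) % n)) % n
  ≡⟨ %-absorbˡ (f fz) _ n ⟩
    (f fz + sumVec k (λ i → f (fs i) % n)) % n
  ≡⟨ sym (%-absorbʳ (f fz) _ n) ⟩
    (f fz + sumVec k (λ i → f (fs i) % n) % n) % n
  ≡⟨ cong (λ z → (f fz + z) % n) (sumVec-% k (f ∘ fs) n) ⟩
    (f fz + sumVec k (f ∘ fs) % n) % n
  ≡⟨ %-absorbʳ (f fz) _ n ⟩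
    (f fz + sumVec k (f ∘ fs)) % n
  ∎
  where open ≡-Reasoning

term≤sumVec : ∀ k (f : Fin k → ℕ) i → f i ≤ sumVec k f
term≤sumVec (suc k) f fz = m≤m+n _ _
term≤sumVec (suc k) f (fs i) = ≤-trans (term≤sumVec k (f ∘ fs) i) (m≤n+m _ _)

nonzero-term : ∀ k (f : Fin k → ℕ) → sumVec k f ≢ 0 → ∃ λ i → f i ≢ 0
nonzero-term zero f nz = ⊥-elim (nz refl)
nonzero-term (suc k) f nz with f fz ≟ 0
... | no p = fz , p
... | yes p =
  let (i , q) = nonzero-term k (f ∘ fs) (λ z → nz (cong₂ _+_ p z)) in fs i , q

sumVec-split : ∀ k (j : Fin k) f → sumVec k f ≡ f j + sumVec k (updateAt f j (const 0))
sumVec-split (suc k) fz f = refl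
sumVec-split (suc k) (fs j) f =
  trans (cong (f fz +_) (sumVec-split k j (f ∘ fs))) (exchange (f fz) (f (fs j)) _)
  where exchange : ∀ a b c → a + (b + c) ≡ b + (a + c)
        exchange = solve-∀

updateAt-cong : ∀ {k} (j : Fin k) {a b} (f g : Fin k → ℕ) → a ≡ b →
                (∀ i → i ≢ j → f i ≡ g i) → ∀ i → updateAt f j (const a) i ≡ updateAt g j (const b) i
updateAt-cong j f g a≡b same i with i FinP.≟ j
... | yes refl = trans (updateAt-updates j f) (trans a≡b (sym (updateAt-updates j g)))
... | no i≢j = trans (updateAt-minimal i j f i≢j) (trans (same i i≢j) (sym (updateAt-minimal i j g i≢j)))

sumVec-below : ∀ k (a : Fin k → ℕ) R → R ≤ sumVec k a →
               ∃ λ e → (∀ i → e i ≤ a i) × sumVec k e ≡ R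
sumVec-below zero a zero le = (λ ()) , (λ ()) , refl
sumVec-below (suc k) a R le with R ≤? sumVec k (a ∘ fs)
... | yes p = let (e , e≤a , Σe) = sumVec-below k (a ∘ fs) R p in
  (λ { fz → 0 ; (fs i) → e i }) , (λ { fz → z≤n ; (fs i) → e≤a i }) , Σe
... | no np =
  (λ { fz → R ∸ S ; (fs i) → a (fs i) }) ,
  (λ { fz → m≤n+o⇒m∸n≤o R S (subst (R ≤_) (+-comm (a fz) S) le) ; (fs i) → ≤-refl }) ,
  m∸n+n≡m (<⇒≤ (≰⇒> np))
  where S = sumVec k (a ∘ fs)

strict-term : ∀ k (e a : Fin k → ℕ) → (∀ i → e i ≤ a i) → sumVec k e < sumVec k a →
              ∃ λ j → e j < a j
strict-term zero e a le ()
strict-term (suc k) e a le lt with m≤n⇒m<n∨m≡n (le fz)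
... | inj₁ p = fz , p
... | inj₂ p =
  let (j , q) = strict-term k (e ∘ fs) (a ∘ fs) (le ∘ fs)
                  (+-cancelˡ-< (a fz) _ _ (subst (λ z → z + _ < _) p lt)) in fs j , q

least-below : (P : ℕ → Set) → (∀ n → Dec (P n)) → ∀ N →
  (∀ L → L < N → ¬ P L) ⊎ (∃ λ r → r < N × P r × (∀ L → L < r → ¬ P L))
least-below P P? zero = inj₁ (λ L ())
least-below P P? (suc N) with least-below P P? N
... | inj₂ (r , r<N , Pr , minimal) = inj₂ (r , m<n⇒m<1+n r<N , Pr , minimal)
... | inj₁ none with P? N
...   | yes PN = inj₂ (N , ≤-refl , PN , none)
...   | no ¬PN = inj₁ (λ L L<1+N → below-or-at L (m≤n⇒m<n∨m≡n (s≤s⁻¹ L<1+N)))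
  where below-or-at : ∀ L → L < N ⊎ L ≡ N → ¬ P L
        below-or-at L (inj₁ L<N) = none L L<N
        below-or-at L (inj₂ refl) = ¬PN

threshold : (P : ℕ → Set) → (∀ n → Dec (P n)) → ∀ N → ¬ P 0 → P N →
            ∃ λ t → ¬ P t × P (suc t)
threshold P P? zero ¬P0 PN = ⊥-elim (¬P0 PN)
threshold P P? (suc N) ¬P0 PN with P? N
... | yes p = threshold P P? N ¬P0 p
... | no ¬p = N , ¬p , PN

minFin : (k : ℕ) → (Fin k → Maybe ℕ) → Maybe ℕ
minFin k f = foldFin k minω nothing f

IsLeastValue : ∀ {k} → (Fin k → Maybe ℕ) → ℕ → Set
IsLeastValue f m = (∀ i r → f i ≡ just r → m ≤ r) × ∃ λ i → f i ≡ just m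

minFin-∞ : ∀ k (f : Fin k → Maybe ℕ) → minFin k f ≡ nothing → ∀ i → f i ≡ nothing
minFin-∞ (suc k) f eq i with f fz in f0 | minFin k (f ∘ fs) in rest
minFin-∞ (suc k) f eq fz     | nothing | nothing = f0
minFin-∞ (suc k) f eq (fs i) | nothing | nothing = minFin-∞ k (f ∘ fs) rest i
minFin-∞ (suc k) f () i | nothing | just _
minFin-∞ (suc k) f () i | just _  | nothing
minFin-∞ (suc k) f () i | just _  | just _

minFin-just : ∀ k (f : Fin k → Maybe ℕ) {m} → minFin k f ≡ just m → IsLeastValue f m
minFin-just (suc k) f {m} eq with f fz in f0 | minFin k (f ∘ fs) in rest
... | nothing | nothing with eq
...   | ()
minFin-just (suc k) f {m} eq | nothing | just y with eq
... | refl = (λ { fz r e → case (trans (sym f0) e) ; (fs i) r e → proj₁ ih i r e })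
           , (fs (proj₁ (proj₂ ih)) , proj₂ (proj₂ ih))
  where ih : IsLeastValue (f ∘ fs) y
        ih = minFin-just k (f ∘ fs) rest
        case : ∀ {r} → nothing ≡ just r → m ≤ r
        case ()
minFin-just (suc k) f {m} eq | just x | nothing with eq
... | refl = (λ { fz r e → ≤-reflexive (just-injective (trans (sym f0) e))
                ; (fs i) r e → case (trans (sym (minFin-∞ k (f ∘ fs) rest i)) e) })
           , (fz , f0)
  where case : ∀ {r} → nothing ≡ just r → m ≤ r
        case ()
minFin-just (suc k) f {m} eq | just x | just y with eq
... | refl = (λ { fz r e → ≤-trans (m⊓n≤m x y) (≤-reflexive (just-injective (trans (sym f0) e)))
                ; (fs i) r e → ≤-trans (m⊓n≤n x y) (proj₁ ih i r e) })
           , attained (⊓-sel x y)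
  where
    ih : IsLeastValue (f ∘ fs) y
    ih = minFin-just k (f ∘ fs) rest
    attained : (x ⊓ y ≡ x) ⊎ (x ⊓ y ≡ y) → ∃ λ i → f i ≡ just (x ⊓ y)
    attained (inj₁ p) = fz , trans f0 (cong just (sym p))
    attained (inj₂ p) = fs (proj₁ (proj₂ ih)) , trans (proj₂ (proj₂ ih)) (cong just (sym p))

minFin-intro : ∀ k (f : Fin k → Maybe ℕ) {m} → IsLeastValue f m → minFin k f ≡ just m
minFin-intro k f {m} (lower , i , fi) with minFin k f in e
... | nothing with trans (sym (minFin-∞ k f e i)) fi
...   | ()
minFin-intro k f {m} (lower , i , fi) | just m' =
  let (lower' , i' , fi') = minFin-just k f e in
  cong just (≤-antisym (lower' i m fi) (lower i' m' fi'))

module OrdGame (β : ℕ → ℕ) (β≥2 : ∀ L → 2 ≤ β L) where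

  β-pos : ∀ L → 0 < β L
  β-pos L = ≤-trans (s≤s z≤n) (β≥2 L)

  B-pos : ∀ L → 0 < B β L
  B-pos zero = s≤s z≤n
  B-pos (suc L) = *-mono-≤ (B-pos L) (β-pos L)

  instance
    β-nonZero : ∀ {L} → NonZero (β L)
    β-nonZero {L} = >-nonZero (β-pos L)

  B-nonZero : ∀ L → NonZero (B β L)
  B-nonZero L = >-nonZero (B-pos L)

  -- n /B L = ⌊n / B_L⌋, the number formed by the digits of index ≥ L.
  infixl 7 _/B_
  _/B_ : ℕ → ℕ → ℕ
  n /B L = _/_ n (B β L) {{B-nonZero L}}

  dig : ℕ → ℕ → ℕ
  dig = digit β

  dig-def : ∀ L n → dig L n ≡ (n /B L) % β L
  dig-def L n = trans (modN≡% (divN n (B β L)) (β L))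
                      (cong (_% β L) (divN≡/ n (B β L) {{B-nonZero L}}))

  dig<β : ∀ L n → dig L n < β L
  dig<β L n = subst (_< β L) (sym (dig-def L n)) (m%n<n _ (β L))

  dig-small : ∀ {L n} → n < B β L → dig L n ≡ 0
  dig-small {L} {n} lt =
    trans (dig-def L n) (trans (cong (_% β L) (m<n⇒m/n≡0 {{B-nonZero L}} lt)) (0%n≡0 (β L)))

  dig-0 : ∀ L → dig L 0 ≡ 0
  dig-0 L = dig-small (B-pos L)

  /B-suc : ∀ n L → n /B suc L ≡ (n /B L) / β L
  /B-suc n L = sym (m/n/o≡m/[n*o] n (B β L) (β L) {{B-nonZero L}} {{β-nonZero {L}}} {{B-nonZero (suc L)}})

  /B-step : ∀ L n → n /B L ≡ dig L n + β L * (n /B suc L)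
  /B-step L n = begin
      n /B L
    ≡⟨ m≡m%n+[m/n]*n (n /B L) (β L) ⟩
      (n /B L) % β L + ((n /B L) / β L) * β L
    ≡⟨ cong₂ _+_ (sym (dig-def L n)) (trans (*-comm _ (β L)) (cong (β L *_) (sym (/B-suc n L)))) ⟩
      dig L n + β L * (n /B suc L)
    ∎
    where open ≡-Reasoning

  dig-add-multiple : ∀ t y Q → dig t (y + B β t * Q) ≡ (dig t y + Q) % β t
  dig-add-multiple t y Q = trans (dig-def t _)
    (trans (cong (_% β t) (+-*-/ y (B β t) Q {{B-nonZero t}}))
      (trans (sym (%-absorbˡ (y /B t) Q (β t))) (cong (λ z → (z + Q) % β t) (sym (dig-def t y)))))

  dig-of-multiple : ∀ t Q → dig t (B β t * Q) ≡ Q % β t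
  dig-of-multiple t Q = trans (dig-add-multiple t 0 Q) (cong (λ z → (z + Q) % β t) (dig-0 t))

  dig-below-multiple : ∀ t L → L < t → ∀ a K → dig L (a + B β t * K) ≡ dig L a
  dig-below-multiple (suc t) L (s≤s L≤t) a K =
    trans (cong (λ z → dig L (a + z)) (*-assoc (B β t) (β t) K)) (by-position (m≤n⇒m<n∨m≡n L≤t))
    where
      by-position : L < t ⊎ L ≡ t → dig L (a + B β t * (β t * K)) ≡ dig L a
      by-position (inj₁ L<t) = dig-below-multiple t L L<t a (β t * K)
      by-position (inj₂ refl) = trans (dig-add-multiple L a (β L * K))
        (trans (+-multiple-% (dig L a) K (β L)) (m<n⇒m%n≡m (dig<β L a)))

  dig-below-multiple-0 : ∀ t L → L < t → ∀ K → dig L (B β t * K) ≡ 0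
  dig-below-multiple-0 t L lt K = trans (dig-below-multiple t L lt 0 K) (dig-0 L)

  dig-at-split : ∀ t A Q → A < B β t → dig t (A + B β t * Q) ≡ Q % β t
  dig-at-split t A Q lt =
    trans (dig-add-multiple t A Q) (cong (λ z → (z + Q) % β t) (dig-small lt))

  dig-above-agree : ∀ {M L} n m → M ≤ L → n /B M ≡ m /B M → dig L n ≡ dig L m
  dig-above-agree {M} {L} n m M≤L eq = subst (λ z → dig z n ≡ dig z m) (m∸n+n≡m M≤L)
    (trans (dig-def (L ∸ M + M) n)
      (trans (cong (_% β (L ∸ M + M)) (quotients (L ∸ M))) (sym (dig-def (L ∸ M + M) m))))
    where
      quotients : ∀ d → n /B (d + M) ≡ m /B (d + M)
      quotients zero = eq
      quotients (suc d) = trans (/B-suc n (d + M))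
        (trans (cong (_/ β (d + M)) (quotients d)) (sym (/B-suc m (d + M))))

  B-mono : ∀ {M L} → M ≤ L → B β M ≤ B β L
  B-mono {M} {L} M≤L = subst (λ z → B β M ≤ B β z) (m∸n+n≡m M≤L) (grow (L ∸ M))
    where
      grow : ∀ d → B β M ≤ B β (d + M)
      grow zero = ≤-refl
      grow (suc d) = ≤-trans (grow d) (m≤m*n (B β (d + M)) (β (d + M)) {{β-nonZero {d + M}}})

  -- B_L ≥ 2^L > L; in particular digits of n vanish beyond index n.
  L<B : ∀ L → L < B β L
  L<B zero = s≤s z≤n
  L<B (suc L) = begin-strict
      suc L
    ≡⟨ +-comm 1 L ⟩
      L + 1
    <⟨ +-mono-<-≤ (L<B L) (B-pos L) ⟩
      B β L + B β L
    ≡⟨ trans (cong (B β L +_) (sym (+-identityʳ (B β L)))) (*-comm 2 (B β L)) ⟩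
      B β L * 2
    ≤⟨ *-monoʳ-≤ (B β L) (β≥2 L) ⟩
      B β L * β L
    ∎
    where open ≤-Reasoning

  expansion : ℕ → (ℕ → ℕ) → ℕ
  expansion N e = sumBelow N (λ L → e L * B β L)

  expansion<B : ∀ N (e : ℕ → ℕ) → (∀ L → e L < β L) → expansion N e < B β N
  expansion<B zero e e<β = s≤s z≤n
  expansion<B (suc N) e e<β = begin-strict
      expansion N e + e N * B β N
    <⟨ +-monoˡ-< (e N * B β N) (expansion<B N e e<β) ⟩
      suc (e N) * B β N
    ≤⟨ *-monoˡ-≤ (B β N) (e<β N) ⟩
      β N * B β N
    ≡⟨ *-comm (β N) (B β N) ⟩
      B β N * β N
    ∎
    where open ≤-Reasoning

  digit-expansion : ∀ N n → n ≡ expansion N (λ L → dig L n) + B β N * (n /B N)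
  digit-expansion zero n = sym (trans (+-identityʳ _) (n/1≡n n))
  digit-expansion (suc N) n = begin
      n
    ≡⟨ digit-expansion N n ⟩
      low + B β N * (n /B N)
    ≡⟨ cong (λ z → low + B β N * z) (/B-step N n) ⟩
      low + B β N * (dig N n + β N * (n /B suc N))
    ≡⟨ regroup low (dig N n) (B β N) (n /B suc N) (β N) ⟩
      expansion (suc N) (λ L → dig L n) + B β (suc N) * (n /B suc N)
    ∎
    where
      open ≡-Reasoning
      low : ℕ
      low = expansion N (λ L → dig L n)
      regroup : ∀ S d b q c → S + b * (d + c * q) ≡ (S + d * b) + b * c * q
      regroup = solve-∀

  digit-expansion-small : ∀ N n → n < B β N → n ≡ expansion N (λ L → dig L n)
  digit-expansion-small N n lt = trans (digit-expansion N n)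
    (trans (cong (λ z → expansion N (λ L → dig L n) + B β N * z) (m<n⇒m/n≡0 {{B-nonZero N}} lt))
      (trans (cong (expansion N (λ L → dig L n) +_) (*-zeroʳ (B β N))) (+-identityʳ _)))

  digits-ext-below : ∀ N a b → a < B β N → b < B β N → (∀ L → L < N → dig L a ≡ dig L b) → a ≡ b
  digits-ext-below N a b a< b< same = trans (digit-expansion-small N a a<)
    (trans (sumBelow-cong N _ _ (λ L lt → cong (_* B β L) (same L lt))) (sym (digit-expansion-small N b b<)))

  digits-ext : ∀ a b → (∀ L → dig L a ≡ dig L b) → a ≡ b
  digits-ext a b same = digits-ext-below (suc (a + b)) a b
    (<-trans (s≤s (m≤m+n a b)) (L<B _)) (<-trans (s≤s (m≤n+m b a)) (L<B _)) (λ L _ → same L)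

  low-zero⇒multiple : ∀ N n → (∀ L → L < N → dig L n ≡ 0) → n ≡ B β N * (n /B N)
  low-zero⇒multiple N n zero-below = trans (digit-expansion N n)
    (cong (_+ B β N * (n /B N)) (sumBelow-zero N _ (λ L lt → cong (_* B β L) (zero-below L lt))))

  expansion-digit : ∀ N (e : ℕ → ℕ) → (∀ L → e L < β L) → ∀ L → L < N → dig L (expansion N e) ≡ e L
  expansion-digit (suc N) e e<β L (s≤s L≤N) with m≤n⇒m<n∨m≡n L≤N
  ... | inj₁ L<N = trans (cong (λ z → dig L (expansion N e + z)) (*-comm (e N) (B β N)))
                     (trans (dig-below-multiple N L L<N _ (e N)) (expansion-digit N e e<β L L<N))
  ... | inj₂ refl = trans (cong (λ z → dig L (expansion L e + z)) (*-comm (e L) (B β L)))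
                     (trans (dig-at-split L _ (e L) (expansion<B L e e<β)) (m<n⇒m%n≡m (e<β L)))

  expansion-digit-above : ∀ N (e : ℕ → ℕ) → (∀ L → e L < β L) → ∀ L → N ≤ L → dig L (expansion N e) ≡ 0
  expansion-digit-above N e e<β L N≤L = dig-small (<-≤-trans (expansion<B N e e<β) (B-mono N≤L))

  ⊕-digits : ℕ → ℕ → ℕ → ℕ
  ⊕-digits a b L = (dig L a + dig L b) % β L

  ⊕-is-expansion : ∀ a b → a ⊕[ β ] b ≡ expansion (suc (a + b)) (⊕-digits a b)
  ⊕-is-expansion a b = sumBelow-cong (suc (a + b)) _ _ (λ L _ → cong (_* B β L) (modN≡% _ (β L)))

  ⊕-digit : ∀ L a b → dig L (a ⊕[ β ] b) ≡ (dig L a + dig L b) % β L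
  ⊕-digit L a b with L <? suc (a + b)
  ... | yes lt = trans (cong (dig L) (⊕-is-expansion a b))
                       (expansion-digit (suc (a + b)) (⊕-digits a b) (λ L → m%n<n _ (β L)) L lt)
  ... | no nlt = trans (cong (dig L) (⊕-is-expansion a b))
      (trans (expansion-digit-above (suc (a + b)) (⊕-digits a b) (λ L → m%n<n _ (β L)) L (≮⇒≥ nlt))
        (sym (trans (cong₂ (λ x y → (x + y) % β L) (dig-small a<B) (dig-small b<B)) (0%n≡0 (β L)))))
    where
      a+b<B : a + b < B β L
      a+b<B = <-trans (≤-trans (n<1+n _) (≮⇒≥ nlt)) (L<B L)
      a<B : a < B β L
      a<B = ≤-<-trans (m≤m+n a b) a+b<B
      b<B : b < B β L
      b<B = ≤-<-trans (m≤n+m b a) a+b<B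

  IsOrd : ℕ → ℕ → Set
  IsOrd n r = dig r n ≢ 0 × (∀ L → L < r → dig L n ≡ 0)

  private
    ≡ᵇ0⇒digit≡0 : ∀ L n → T (digit β L n ≡ᵇ 0) → dig L n ≡ 0
    ≡ᵇ0⇒digit≡0 L n = ≡ᵇ⇒≡ (digit β L n) 0

    ≢ᵇ0⇒digit≢0 : ∀ L n → (digit β L n ≡ᵇ 0) ≡ false → dig L n ≢ 0
    ≢ᵇ0⇒digit≢0 L n e z = subst T e (≡⇒≡ᵇ _ 0 z)

  ordFrom-just : ∀ n L fuel {r} → ordFrom β n L fuel ≡ just r →
                 dig r n ≢ 0 × L ≤ r × (∀ L' → L ≤ L' → L' < r → dig L' n ≡ 0)
  ordFrom-just n L (suc fuel) eq with digit β L n ≡ᵇ 0 in e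
  ... | true = let (nz , L<r , zeros) = ordFrom-just n (suc L) fuel eq in
    nz , ≤-trans (n≤1+n L) L<r , λ L' L≤L' L'<r → step L' (m≤n⇒m<n∨m≡n L≤L') L'<r zeros
    where
      step : ∀ {r} L' → L < L' ⊎ L ≡ L' → L' < r →
             (∀ L' → suc L ≤ L' → L' < r → dig L' n ≡ 0) → dig L' n ≡ 0
      step L' (inj₁ L<L') L'<r zeros = zeros L' L<L' L'<r
      step L' (inj₂ refl) _ _ = ≡ᵇ0⇒digit≡0 L n (subst T (sym e) _)
  ... | false with eq
  ...   | refl = ≢ᵇ0⇒digit≢0 L n e , ≤-refl , λ L' L≤L' L'<L → ⊥-elim (<-irrefl refl (≤-<-trans L≤L' L'<L))

  ordFrom-∞ : ∀ n L fuel → ordFrom β n L fuel ≡ nothing →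
              ∀ L' → L ≤ L' → L' < fuel + L → dig L' n ≡ 0
  ordFrom-∞ n L zero eq L' L≤L' lt = ⊥-elim (<-irrefl refl (≤-<-trans L≤L' lt))
  ordFrom-∞ n L (suc fuel) eq L' L≤L' lt with digit β L n ≡ᵇ 0 in e
  ... | true with m≤n⇒m<n∨m≡n L≤L'
  ...   | inj₁ L<L' = ordFrom-∞ n (suc L) fuel eq L' L<L' (subst (L' <_) (sym (+-suc fuel L)) lt)
  ...   | inj₂ refl = ≡ᵇ0⇒digit≡0 L n (subst T (sym e) _)
  ordFrom-∞ n L (suc fuel) () L' L≤L' lt | false

  ord-just : ∀ n {r} → ord β n ≡ just r → IsOrd n r
  ord-just n eq = let (nz , _ , zeros) = ordFrom-just n 0 (suc n) eq in nz , λ L lt → zeros L z≤n lt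

  ord-∞ : ∀ n → ord β n ≡ nothing → n ≡ 0
  ord-∞ n eq = trans (digit-expansion-small (suc n) n (<-trans (n<1+n n) (L<B (suc n))))
    (sumBelow-zero (suc n) _ (λ L lt → cong (_* B β L)
      (ordFrom-∞ n 0 (suc n) eq L z≤n (subst (L <_) (sym (+-identityʳ _)) lt))))

  ord-intro : ∀ n r → IsOrd n r → ord β n ≡ just r
  ord-intro n r (nz , zeros) with ord β n in e
  ... | nothing = ⊥-elim (nz (trans (cong (dig r) (ord-∞ n e)) (dig-0 r)))
  ... | just r' with <-cmp r r'
  ...   | tri< r<r' _ _ = ⊥-elim (nz (proj₂ (ord-just n e) r r<r'))
  ...   | tri≈ _ refl _ = refl
  ...   | tri> _ _ r'<r = ⊥-elim (proj₁ (ord-just n e) (zeros r' r'<r))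

  LowZero : ∀ {k} → (Fin k → ℕ) → ℕ → Set
  LowZero X t = ∀ i L → L < t → dig L (X i) ≡ 0

  IsMord : ∀ {k} → (Fin k → ℕ) → ℕ → Set
  IsMord X m = LowZero X m × ∃ λ i → dig m (X i) ≢ 0

  mord-just : ∀ k X {m} → mord β k X ≡ just m → IsMord X m
  mord-just k X {m} eq = low-zero , (i , proj₁ (ord-just (X i) ord-i))
    where
      least : IsLeastValue (λ i → ord β (X i)) m
      least = minFin-just k (λ i → ord β (X i)) eq
      i : Fin k
      i = proj₁ (proj₂ least)
      ord-i : ord β (X i) ≡ just m
      ord-i = proj₂ (proj₂ least)
      low-zero : LowZero X m
      low-zero i L lt with ord β (X i) in e
      ... | nothing = trans (cong (dig L) (ord-∞ (X i) e)) (dig-0 L)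
      ... | just r = proj₂ (ord-just (X i) e) L (<-≤-trans lt (proj₁ least i r e))

  mord-intro : ∀ k X m → IsMord X m → mord β k X ≡ just m
  mord-intro k X m (low-zero , i , nz) =
    minFin-intro k (λ i → ord β (X i)) (lower , i , ord-intro (X i) m (nz , low-zero i))
    where
      lower : ∀ i r → ord β (X i) ≡ just r → m ≤ r
      lower i r e with r <? m
      ... | yes r<m = ⊥-elim (proj₁ (ord-just (X i) e) (low-zero i r r<m))
      ... | no r≮m = ≮⇒≥ r≮m

  mord-defined : ∀ k X → Pmis k X → ∃ λ m → mord β k X ≡ just m
  mord-defined k X X≢0 with mord β k X in e
  ... | just m = m , refl
  ... | nothing = ⊥-elim (X≢0 (λ i → ord-∞ (X i) (minFin-∞ k (λ i → ord β (X i)) e i)))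

  mord-nonzero : ∀ k Y {μ} → mord β k Y ≡ just μ → Pmis k Y
  mord-nonzero k Y eq all-zero =
    let (i , nz) = proj₂ (mord-just k Y eq) in nz (trans (cong (dig _) (all-zero i)) (dig-0 _))

  mordℕ-just : ∀ k X {m} → mord β k X ≡ just m → mordℕ β k X ≡ m
  mordℕ-just k X eq rewrite eq = refl

  LowZero⇒≤mord : ∀ k X {m} t → mord β k X ≡ just m → LowZero X t → t ≤ m
  LowZero⇒≤mord k X {m} t eq zeros with m <? t
  ... | yes m<t = let (i , nz) = proj₂ (mord-just k X eq) in ⊥-elim (nz (zeros i m m<t))
  ... | no m≮t = ≮⇒≥ m≮t

  ≤mord⇒LowZero : ∀ k X {m} t → mord β k X ≡ just m → t ≤ m → LowZero X t
  ≤mord⇒LowZero k X t eq t≤m i L lt = proj₁ (mord-just k X eq) i L (<-≤-trans lt t≤m)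

  -- The digits of φ

  digitSum : ℕ → (k : ℕ) → (Fin k → ℕ) → ℕ
  digitSum L k X = sumVec k (λ i → dig L (X i))

  ⊕-fold : (k : ℕ) → (Fin k → ℕ) → ℕ
  ⊕-fold k X = foldFin k (λ a b → a ⊕[ β ] b) 0 X

  ⊕-fold-digit : ∀ L k X → dig L (⊕-fold k X) ≡ digitSum L k X % β L
  ⊕-fold-digit L zero X = trans (dig-0 L) (sym (0%n≡0 (β L)))
  ⊕-fold-digit L (suc k) X = trans (⊕-digit L (X fz) (⊕-fold k (X ∘ fs)))
     (trans (cong (λ z → (dig L (X fz) + z) % β L) (⊕-fold-digit L k (X ∘ fs)))
       (%-absorbʳ (dig L (X fz)) _ (β L)))

  B-1-expansion : ∀ N → B β N ∸ 1 ≡ expansion N (λ L → β L ∸ 1)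
  B-1-expansion N = trans (cong (_∸ 1) (sym (expansion+1 N))) (m+n∸n≡m _ 1)
    where
      expansion+1 : ∀ N → expansion N (λ L → β L ∸ 1) + 1 ≡ B β N
      expansion+1 zero = refl
      expansion+1 (suc N) = begin
          S + (β N ∸ 1) * B β N + 1
        ≡⟨ trans (+-assoc S _ 1) (trans (cong (S +_) (+-comm _ 1)) (sym (+-assoc S 1 _))) ⟩
          (S + 1) + (β N ∸ 1) * B β N
        ≡⟨ cong (_+ (β N ∸ 1) * B β N) (expansion+1 N) ⟩
          (1 + (β N ∸ 1)) * B β N
        ≡⟨ cong (_* B β N) (m+[n∸m]≡n (β-pos N)) ⟩
          β N * B β N
        ≡⟨ *-comm (β N) (B β N) ⟩
          B β N * β N
        ∎
        where
          open ≡-Reasoning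
          S : ℕ
          S = expansion N (λ L → β L ∸ 1)

  B-1-digit-below : ∀ N L → L < N → dig L (B β N ∸ 1) ≡ β L ∸ 1
  B-1-digit-below N L lt = trans (cong (dig L) (B-1-expansion N))
    (expansion-digit N (λ L → β L ∸ 1) (λ L → pred<self _ (β-pos L)) L lt)

  B-1-digit-above : ∀ N L → N ≤ L → dig L (B β N ∸ 1) ≡ 0
  B-1-digit-above N L le = trans (cong (dig L) (B-1-expansion N))
    (expansion-digit-above N (λ L → β L ∸ 1) (λ L → pred<self _ (β-pos L)) L le)

  φ-digit-≤ : ∀ k X {m} → mord β k X ≡ just m → ∀ L → L ≤ m →
              dig L (φ β k X) ≡ (digitSum L k X + (β L ∸ 1)) % β L
  φ-digit-≤ k X {m} eq L L≤m rewrite mordℕ-just k X eq =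
    trans (⊕-digit L (⊕-fold k X) (B β (suc m) ∸ 1))
      (trans (cong₂ (λ a b → (a + b) % β L) (⊕-fold-digit L k X) (B-1-digit-below (suc m) L (s≤s L≤m)))
        (%-absorbˡ (digitSum L k X) _ (β L)))

  φ-digit-> : ∀ k X {m} → mord β k X ≡ just m → ∀ L → m < L →
              dig L (φ β k X) ≡ digitSum L k X % β L
  φ-digit-> k X {m} eq L m<L rewrite mordℕ-just k X eq =
    trans (⊕-digit L (⊕-fold k X) (B β (suc m) ∸ 1))
      (trans (cong₂ (λ a b → (a + b) % β L) (⊕-fold-digit L k X) (B-1-digit-above (suc m) L m<L))
        (trans (cong (_% β L) (+-identityʳ _)) (m%n%n≡m%n _ (β L))))

  φ-digit-< : ∀ k X {m} → mord β k X ≡ just m → ∀ L → L < m → dig L (φ β k X) ≡ β L ∸ 1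
  φ-digit-< k X eq L L<m = trans (φ-digit-≤ k X eq L (<⇒≤ L<m))
    (trans (cong (λ z → (z + (β L ∸ 1)) % β L)
                 (sumVec-zero k _ (λ i → proj₁ (mord-just k X eq) i L L<m)))
           (m<n⇒m%n≡m (pred<self _ (β-pos L))))

  LowZero? : ∀ k X → Pmis k X → ∀ t → Dec (LowZero X t)
  LowZero? k X X≢0 t with mord-defined k X X≢0
  ... | m , eq with t ≤? m
  ...   | yes t≤m = yes (≤mord⇒LowZero k X t eq t≤m)
  ...   | no t≰m = no (λ zeros → t≰m (LowZero⇒≤mord k X t eq zeros))

  φ-digit-LowZero : ∀ k X → Pmis k X → ∀ t → LowZero X t →
                    dig t (φ β k X) ≡ (digitSum t k X + (β t ∸ 1)) % β t
  φ-digit-LowZero k X X≢0 t zeros =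
    let (m , eq) = mord-defined k X X≢0 in φ-digit-≤ k X eq t (LowZero⇒≤mord k X t eq zeros)

  φ-digit-¬LowZero : ∀ k X → Pmis k X → ∀ t → ¬ LowZero X t →
                     dig t (φ β k X) ≡ (digitSum t k X + 0) % β t
  φ-digit-¬LowZero k X X≢0 t nonzero =
    let (m , eq) = mord-defined k X X≢0 in
    trans (φ-digit-> k X eq t (≰⇒> (λ t≤m → nonzero (≤mord⇒LowZero k X t eq t≤m))))
          (cong (_% β t) (sym (+-identityʳ _)))

  common-shift : ∀ k X Y → Pmis k X → Pmis k Y → ∀ t →
    (∀ i L → L < t → dig L (X i) ≡ dig L (Y i)) →
    ∃ λ c → (dig t (φ β k X) ≡ (digitSum t k X + c) % β t) × (dig t (φ β k Y) ≡ (digitSum t k Y + c) % β t)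
  common-shift k X Y X≢0 Y≢0 t agree with LowZero? k X X≢0 t
  ... | yes zeros = β t ∸ 1 , φ-digit-LowZero k X X≢0 t zeros
      , φ-digit-LowZero k Y Y≢0 t (λ i L lt → trans (sym (agree i L lt)) (zeros i L lt))
  ... | no nonzero = 0 , φ-digit-¬LowZero k X X≢0 t nonzero
      , φ-digit-¬LowZero k Y Y≢0 t (λ zeros → nonzero (λ i L lt → trans (agree i L lt) (zeros i L lt)))

  -- Half (1) of the Sprague–Grundy recursion: φ changes along every move

  CordOption : (k : ℕ) → (Fin k → ℕ) → (Fin k → ℕ) → Set
  CordOption k = Option k (Pmis k) (Cord β k)

  -- Write a move as X_i = Y_i + B_t·Q_i with t = mord(X − Y); the move shifts
  -- the digit sum at t by ΣQ, which is nonzero mod β_t because ord(ΣC) = t.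
  -- Below t nothing changes, so the shift at digit t is common to X and Y and
  -- digit t of φ differs.
  φ-changes : ∀ k X Y → CordOption k X Y → φ β k Y ≢ φ β k X
  φ-changes k X Y (X≢0 , Y≢0 , Y≤X , C≢0 , ordΣC) φY≡φX =
    ΣQ≢0 (%-cancelˡ (digitSum t k Y + c) ΣQ (β t) shift-invisible)
    where
      C : Fin k → ℕ
      C i = X i ∸ Y i
      t : ℕ
      t = proj₁ (mord-defined k C C≢0)
      mordC : mord β k C ≡ just t
      mordC = proj₂ (mord-defined k C C≢0)
      Q : Fin k → ℕ
      Q i = C i /B t
      ΣQ : ℕ
      ΣQ = sumVec k Q
      C≡BQ : ∀ i → C i ≡ B β t * Q i
      C≡BQ i = low-zero⇒multiple t (C i) (proj₁ (mord-just k C mordC) i)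
      X≡Y+BQ : ∀ i → X i ≡ Y i + B β t * Q i
      X≡Y+BQ i = trans (sym (m+[n∸m]≡n (Y≤X i))) (cong (Y i +_) (C≡BQ i))
      agree : ∀ i L → L < t → dig L (X i) ≡ dig L (Y i)
      agree i L lt = trans (cong (dig L) (X≡Y+BQ i)) (dig-below-multiple t L lt (Y i) (Q i))
      ΣC≡BΣQ : sumVec k C ≡ B β t * ΣQ
      ΣC≡BΣQ = trans (sumVec-cong k C _ C≡BQ) (sumVec-*ˡ k (B β t) Q)
      ΣQ≢0 : ΣQ % β t ≢ 0
      ΣQ≢0 z = proj₁ (ord-just (sumVec k C) (trans ordΣC mordC))
                 (trans (cong (dig t) ΣC≡BΣQ) (trans (dig-of-multiple t ΣQ) z))
      sX≡sY+ΣQ : digitSum t k X % β t ≡ (digitSum t k Y + ΣQ) % β t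
      sX≡sY+ΣQ = begin
          digitSum t k X % β t
        ≡⟨ cong (_% β t) (sumVec-cong k _ _ (λ i → trans (cong (dig t) (X≡Y+BQ i)) (dig-add-multiple t (Y i) (Q i)))) ⟩
          sumVec k (λ i → (dig t (Y i) + Q i) % β t) % β t
        ≡⟨ sumVec-% k (λ i → dig t (Y i) + Q i) (β t) ⟩
          sumVec k (λ i → dig t (Y i) + Q i) % β t
        ≡⟨ cong (_% β t) (sumVec-+ k _ _) ⟩
          (digitSum t k Y + ΣQ) % β t
        ∎
        where open ≡-Reasoning
      shift : ∃ λ c → (dig t (φ β k X) ≡ (digitSum t k X + c) % β t)
                    × (dig t (φ β k Y) ≡ (digitSum t k Y + c) % β t)
      shift = common-shift k X Y X≢0 Y≢0 t agree
      c : ℕ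
      c = proj₁ shift
      shift-invisible : (digitSum t k Y + c + ΣQ) % β t ≡ (digitSum t k Y + c) % β t
      shift-invisible = begin
          (digitSum t k Y + c + ΣQ) % β t
        ≡⟨ cong (_% β t) (trans (+-assoc _ c ΣQ) (trans (cong (digitSum t k Y +_) (+-comm c ΣQ)) (sym (+-assoc _ ΣQ c)))) ⟩
          (digitSum t k Y + ΣQ + c) % β t
        ≡⟨ sym (%-absorbˡ _ c (β t)) ⟩
          ((digitSum t k Y + ΣQ) % β t + c) % β t
        ≡⟨ cong (λ z → (z + c) % β t) (sym sX≡sY+ΣQ) ⟩
          (digitSum t k X % β t + c) % β t
        ≡⟨ %-absorbˡ _ c (β t) ⟩
          (digitSum t k X + c) % β t
        ≡⟨ sym (proj₁ (proj₂ shift)) ⟩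
          dig t (φ β k X)
        ≡⟨ cong (dig t) (sym φY≡φX) ⟩
          dig t (φ β k Y)
        ≡⟨ proj₂ (proj₂ shift) ⟩
          (digitSum t k Y + c) % β t
        ∎
        where open ≡-Reasoning

  highest-difference : ∀ v w → v < w →
    ∃ λ t → dig t v < dig t w × (∀ L → t < L → dig L v ≡ dig L w)
  highest-difference v w v<w =
    let (t , differ , agree) = threshold (λ t → v /B t ≡ w /B t) (λ t → v /B t ≟ w /B t)
                                         (suc w) differ-at-0 agree-at-top
    in t , smaller-digit t differ agree , (λ L t<L → dig-above-agree v w t<L agree)
    where
      differ-at-0 : ¬ (v /B 0 ≡ w /B 0)
      differ-at-0 eq = <-irrefl (trans (sym (n/1≡n v)) (trans eq (n/1≡n w))) v<w
      w<B : w < B β (suc w)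
      w<B = <-trans (n<1+n w) (L<B (suc w))
      agree-at-top : v /B suc w ≡ w /B suc w
      agree-at-top = trans (m<n⇒m/n≡0 {{B-nonZero (suc w)}} (<-trans v<w w<B))
                           (sym (m<n⇒m/n≡0 {{B-nonZero (suc w)}} w<B))
      -- At the threshold v /B t and w /B t differ only in their last digit.
      smaller-digit : ∀ t → ¬ (v /B t ≡ w /B t) → v /B suc t ≡ w /B suc t → dig t v < dig t w
      smaller-digit t differ agree = ≤∧≢⇒<
          (+-cancelʳ-≤ (β t * (v /B suc t)) (dig t v) (dig t w)
            (subst₂ _≤_ v/B≡ w/B≡ (/-monoˡ-≤ (B β t) {{B-nonZero t}} (<⇒≤ v<w))))
          (λ same → differ (trans v/B≡ (trans (cong (λ z → z + β t * (v /B suc t)) same) (sym w/B≡))))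
        where
          v/B≡ : v /B t ≡ dig t v + β t * (v /B suc t)
          v/B≡ = /B-step t v
          w/B≡ : w /B t ≡ dig t w + β t * (v /B suc t)
          w/B≡ = trans (/B-step t w) (cong (λ z → dig t w + β t * z) (sym agree))

  -- A move whose coordinates other than j vanish below ℓ while C_j does not
  -- is a C_ord move: the lowest nonzero digit of C_j is both mord C and ord ΣC.
  cord-one-low : ∀ k (C : Fin k → ℕ) ℓ j →
    (∀ i → i ≢ j → ∀ L → L < ℓ → dig L (C i) ≡ 0) → ¬ (∀ L → L < ℓ → dig L (C j) ≡ 0) → Cord β k C
  cord-one-low k C ℓ j others-zero Cj-nonzero
    with least-below (λ L → dig L (C j) ≢ 0) (λ L → ¬? (dig L (C j) ≟ 0)) ℓ
  ... | inj₁ none = ⊥-elim (Cj-nonzero (λ L lt → decidable-stable (dig L (C j) ≟ 0) (none L lt)))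
  ... | inj₂ (r , r<ℓ , nz , minimal) = mord-nonzero k C mordC , trans ordΣC (sym mordC)
    where
      low-zero : LowZero C r
      low-zero i L L<r with i FinP.≟ j
      ... | yes refl = decidable-stable (dig L (C i) ≟ 0) (minimal L L<r)
      ... | no i≢j = others-zero i i≢j L (<-trans L<r r<ℓ)
      mordC : mord β k C ≡ just r
      mordC = mord-intro k C r (low-zero , j , nz)
      rest : ℕ
      rest = sumVec k (updateAt C j (const 0))
      rest-low-zero : ∀ L → L < ℓ → dig L rest ≡ 0
      rest-low-zero L L<ℓ = trans (cong (dig L)
          (trans (sumVec-cong k _ _ (λ i → low-zero⇒multiple ℓ _ (zero-below i))) (sumVec-*ˡ k (B β ℓ) _)))
        (dig-below-multiple-0 ℓ L L<ℓ _)
        where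
          zero-below : ∀ i L → L < ℓ → dig L (updateAt C j (const 0) i) ≡ 0
          zero-below i L lt with i FinP.≟ j
          ... | yes refl = trans (cong (dig L) (updateAt-updates j C)) (dig-0 L)
          ... | no i≢j = trans (cong (dig L) (updateAt-minimal i j C i≢j)) (others-zero i i≢j L lt)
      ΣC-digit : ∀ L → L < ℓ → dig L (sumVec k C) ≡ dig L (C j)
      ΣC-digit L L<ℓ = trans (cong (dig L) (trans (sumVec-split k j C)
                                (cong (C j +_) (low-zero⇒multiple ℓ rest rest-low-zero))))
                             (dig-below-multiple ℓ L L<ℓ (C j) _)
      ordΣC : ord β (sumVec k C) ≡ just r
      ordΣC = ord-intro _ r ((λ z → nz (trans (sym (ΣC-digit r r<ℓ)) z))
                            , (λ L L<r → trans (ΣC-digit L (<-trans L<r r<ℓ)) (low-zero j L L<r)))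

  -- A move C = B_ℓ·δ with digits δ_i < β_ℓ and Σδ ≢ 0 (mod β_ℓ) is a
  -- C_ord move: mord C = ord ΣC = ℓ.
  cord-aligned : ∀ k (C : Fin k → ℕ) ℓ (δ : Fin k → ℕ) → (∀ i → C i ≡ B β ℓ * δ i) →
                 (∀ i → δ i < β ℓ) → sumVec k δ % β ℓ ≢ 0 → Cord β k C
  cord-aligned k C ℓ δ C≡Bδ δ<β Σδ≢0 = mord-nonzero k C mordC , trans ordΣC (sym mordC)
    where
      nonzero : ∃ λ i → δ i ≢ 0
      nonzero = nonzero-term k δ (λ z → Σδ≢0 (trans (cong (_% β ℓ) z) (0%n≡0 (β ℓ))))
      i₀ : Fin k
      i₀ = proj₁ nonzero
      mordC : mord β k C ≡ just ℓ
      mordC = mord-intro k C ℓ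
        ( (λ i L lt → trans (cong (dig L) (C≡Bδ i)) (dig-below-multiple-0 ℓ L lt (δ i)))
        , i₀ , λ z → proj₂ nonzero (trans (sym (m<n⇒m%n≡m (δ<β i₀)))
                       (trans (sym (dig-of-multiple ℓ (δ i₀))) (trans (cong (dig ℓ) (sym (C≡Bδ i₀))) z))))
      ΣC≡BΣδ : sumVec k C ≡ B β ℓ * sumVec k δ
      ΣC≡BΣδ = trans (sumVec-cong k C _ C≡Bδ) (sumVec-*ˡ k (B β ℓ) δ)
      ordΣC : ord β (sumVec k C) ≡ just ℓ
      ordΣC = ord-intro _ ℓ
        ( (λ z → Σδ≢0 (trans (sym (dig-of-multiple ℓ _)) (trans (cong (dig ℓ) (sym ΣC≡BΣδ)) z)))
        , (λ L lt → trans (cong (dig L) ΣC≡BΣδ) (dig-below-multiple-0 ℓ L lt _)))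

  -- compose ℓ lo e H = lo + B_ℓ·(e + β_ℓ·H): low part lo < B_ℓ, digit e at
  -- position ℓ, and the digits above ℓ those of H.
  compose : ℕ → ℕ → ℕ → ℕ → ℕ
  compose ℓ lo e H = lo + B β ℓ * (e + β ℓ * H)

  lowPart : ℕ → ℕ → ℕ
  lowPart x ℓ = _%_ x (B β ℓ) {{B-nonZero ℓ}}

  lowPart<B : ∀ x ℓ → lowPart x ℓ < B β ℓ
  lowPart<B x ℓ = m%n<n x (B β ℓ) {{B-nonZero ℓ}}

  low+high : ∀ x ℓ → x ≡ lowPart x ℓ + B β ℓ * (x /B ℓ)
  low+high x ℓ = trans (m≡m%n+[m/n]*n x (B β ℓ) {{B-nonZero ℓ}}) (cong (lowPart x ℓ +_) (*-comm (x /B ℓ) (B β ℓ)))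

  compose-self : ∀ x ℓ → x ≡ compose ℓ (lowPart x ℓ) (dig ℓ x) (x /B suc ℓ)
  compose-self x ℓ = trans (low+high x ℓ) (cong (λ z → lowPart x ℓ + B β ℓ * z) (/B-step ℓ x))

  lowPart-digit : ∀ x ℓ L → L < ℓ → dig L (lowPart x ℓ) ≡ dig L x
  lowPart-digit x ℓ L lt = sym (trans (cong (dig L) (low+high x ℓ)) (dig-below-multiple ℓ L lt _ _))

  compose-digit-below : ∀ ℓ lo e H L → L < ℓ → dig L (compose ℓ lo e H) ≡ dig L lo
  compose-digit-below ℓ lo e H L lt = dig-below-multiple ℓ L lt lo _

  compose-digit-at : ∀ ℓ lo e H → lo < B β ℓ → e < β ℓ → dig ℓ (compose ℓ lo e H) ≡ e
  compose-digit-at ℓ lo e H lo< e< =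
    trans (dig-at-split ℓ lo _ lo<) (digit-residue (β ℓ) e H e<)

  compose-high : ∀ ℓ lo e H → lo < B β ℓ → e < β ℓ → compose ℓ lo e H /B suc ℓ ≡ H
  compose-high ℓ lo e H lo< e< = trans (cong (_/B suc ℓ) (regroup lo (B β ℓ) e (β ℓ) H))
                                       (+-*-/-small _ (B β (suc ℓ)) H {{B-nonZero (suc ℓ)}} bound)
    where
      regroup : ∀ lo b e c H → lo + b * (e + c * H) ≡ (lo + b * e) + b * c * H
      regroup = solve-∀
      bound : lo + B β ℓ * e < B β ℓ * β ℓ
      bound = begin-strict
          lo + B β ℓ * e
        <⟨ +-monoˡ-< (B β ℓ * e) lo< ⟩
          B β ℓ + B β ℓ * e
        ≡⟨ sym (*-suc (B β ℓ) e) ⟩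
          B β ℓ * suc e
        ≤⟨ *-monoʳ-≤ (B β ℓ) e< ⟩
          B β ℓ * β ℓ
        ∎
        where open ≤-Reasoning

  compose-digit-above : ∀ ℓ lo e x L → lo < B β ℓ → e < β ℓ → ℓ < L →
                        dig L (compose ℓ lo e (x /B suc ℓ)) ≡ dig L x
  compose-digit-above ℓ lo e x L lo< e< ℓ<L = dig-above-agree _ x ℓ<L (compose-high ℓ lo e _ lo< e<)

  compose-≤ : ∀ ℓ lo' lo e a H → lo' ≤ lo → e ≤ a → compose ℓ lo' e H ≤ compose ℓ lo a H
  compose-≤ ℓ lo' lo e a H lo'≤lo e≤a = +-mono-≤ lo'≤lo (*-monoʳ-≤ (B β ℓ) (+-monoˡ-≤ (β ℓ * H) e≤a))

  compose-< : ∀ ℓ lo' lo e a H → lo' < B β ℓ → e < a → compose ℓ lo' e H < compose ℓ lo a H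
  compose-< ℓ lo' lo e a H lo'< e<a = begin-strict
      lo' + B β ℓ * (e + β ℓ * H)
    <⟨ +-monoˡ-< _ lo'< ⟩
      B β ℓ + B β ℓ * (e + β ℓ * H)
    ≡⟨ sym (*-suc (B β ℓ) _) ⟩
      B β ℓ * (suc e + β ℓ * H)
    ≤⟨ *-monoʳ-≤ (B β ℓ) (+-monoˡ-≤ (β ℓ * H) e<a) ⟩
      B β ℓ * (a + β ℓ * H)
    ≤⟨ m≤n+m _ lo ⟩
      lo + B β ℓ * (a + β ℓ * H)
    ∎
    where open ≤-Reasoning

  compose-∸ : ∀ ℓ lo' lo e a H → lo' ≤ lo → e ≤ a →
              compose ℓ lo a H ∸ compose ℓ lo' e H ≡ (lo ∸ lo') + B β ℓ * (a ∸ e)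
  compose-∸ ℓ lo' lo e a H lo'≤lo e≤a = begin
      compose ℓ lo a H ∸ compose ℓ lo' e H
    ≡⟨ cong₂ (λ x y → compose ℓ x y H ∸ compose ℓ lo' e H) (sym (m+[n∸m]≡n lo'≤lo)) (sym (m+[n∸m]≡n e≤a)) ⟩
      compose ℓ (lo' + (lo ∸ lo')) (e + (a ∸ e)) H ∸ compose ℓ lo' e H
    ≡⟨ cong (_∸ compose ℓ lo' e H) (regroup lo' (lo ∸ lo') (B β ℓ) e (a ∸ e) (β ℓ) H) ⟩
      compose ℓ lo' e H + ((lo ∸ lo') + B β ℓ * (a ∸ e)) ∸ compose ℓ lo' e H
    ≡⟨ m+n∸m≡n (compose ℓ lo' e H) _ ⟩
      (lo ∸ lo') + B β ℓ * (a ∸ e)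
    ∎
    where
      open ≡-Reasoning
      regroup : ∀ l d b e d₂ c H → (l + d) + b * ((e + d₂) + c * H) ≡ (l + b * (e + c * H)) + (d + b * d₂)
      regroup = solve-∀

  -- Half (2): constructing an option with a prescribed value v < φ(X)

  -- The data: a position ℓ ≥ mord X and a target v that agrees with φ(X)
  -- above ℓ and whose digit at ℓ can be realised by lowering the digits of X
  -- at ℓ (v-below-sum), with enough room left for a C_ord move (v-residue),
  -- also after a carry into position ℓ (v-carry).
  module Construction (k : ℕ) (X : Fin k → ℕ) (X≢0 : Pmis k X) {m : ℕ} (mordX : mord β k X ≡ just m)
    (ℓ : ℕ) (m≤ℓ : m ≤ ℓ) (v : ℕ)
    (v-above : ∀ L → ℓ < L → dig L v ≡ dig L (φ β k X))
    (v-below-sum : dig ℓ v < digitSum ℓ k X)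
    (v-residue : (dig ℓ v ≢ digitSum ℓ k X % β ℓ) ⊎ LowZero X ℓ)
    (v-carry : (∀ L → L < ℓ → dig L v ≡ β L ∸ 1) →
               (suc (dig ℓ v) < β ℓ) × (suc (dig ℓ v) ≤ digitSum ℓ k X)
               × ((suc (dig ℓ v) ≢ digitSum ℓ k X % β ℓ) ⊎ ¬ LowZero X ℓ))
    where

    vℓ sℓ : ℕ
    vℓ = dig ℓ v
    sℓ = digitSum ℓ k X

    a lo H : Fin k → ℕ
    a i = dig ℓ (X i)
    lo i = lowPart (X i) ℓ
    H i = X i /B suc ℓ

    X≡compose : ∀ i → X i ≡ compose ℓ (lo i) (a i) (H i)
    X≡compose i = compose-self (X i) ℓ

    φ-agrees-above : ∀ Y {μ} → mord β k Y ≡ just μ → μ ≤ ℓ → (∀ i L → ℓ < L → dig L (Y i) ≡ dig L (X i)) →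
                     ∀ L → ℓ < L → dig L (φ β k Y) ≡ dig L v
    φ-agrees-above Y mordY μ≤ℓ same L ℓ<L = trans (φ-digit-> k Y mordY L (≤-<-trans μ≤ℓ ℓ<L))
      (trans (cong (_% β L) (sumVec-cong k _ _ (λ i → same i L ℓ<L)))
        (trans (sym (φ-digit-> k X mordX L (≤-<-trans m≤ℓ ℓ<L))) (sym (v-above L ℓ<L))))

    remainder-nonzero : ∀ (e : Fin k → ℕ) u → (∀ i → e i ≤ a i) → sumVec k e ≡ u → u < β ℓ →
                        u ≢ sℓ % β ℓ → sumVec k (λ i → a i ∸ e i) % β ℓ ≢ 0
    remainder-nonzero e u e≤a Σe≡u u<β u≢s z = u≢s (sym (begin
        sℓ % β ℓ
      ≡⟨ cong (_% β ℓ) (sym (sumVec-cong k _ _ (λ i → m∸n+n≡m (e≤a i)))) ⟩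
        sumVec k (λ i → a i ∸ e i + e i) % β ℓ
      ≡⟨ cong (_% β ℓ) (trans (sumVec-+ k _ _) (cong (_ +_) Σe≡u)) ⟩
        (sumVec k (λ i → a i ∸ e i) + u) % β ℓ
      ≡⟨ sym (%-absorbˡ _ u (β ℓ)) ⟩
        (sumVec k (λ i → a i ∸ e i) % β ℓ + u) % β ℓ
      ≡⟨ cong (λ z → (z + u) % β ℓ) z ⟩
        u % β ℓ
      ≡⟨ m<n⇒m%n≡m u<β ⟩
        u
      ∎))
      where open ≡-Reasoning

    lowered : ∃ λ e → (∀ i → e i ≤ a i) × sumVec k e ≡ vℓ
    lowered = sumVec-below k a vℓ (<⇒≤ v-below-sum)
    e : Fin k → ℕ
    e = proj₁ lowered
    e≤a : ∀ i → e i ≤ a i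
    e≤a = proj₁ (proj₂ lowered)
    Σe≡vℓ : sumVec k e ≡ vℓ
    Σe≡vℓ = proj₂ (proj₂ lowered)
    e<β : ∀ i → e i < β ℓ
    e<β i = ≤-<-trans (e≤a i) (dig<β ℓ (X i))
    dropping : ∃ λ j → e j < a j
    dropping = strict-term k e a e≤a (subst (_< sℓ) (sym Σe≡vℓ) v-below-sum)
    j : Fin k
    j = proj₁ dropping
    ej<aj : e j < a j
    ej<aj = proj₂ dropping

    OthersZero : ℕ → Set
    OthersZero L = ∀ i → i ≢ j → dig L (X i) ≡ 0

    OthersZero? : ∀ L → Dec (OthersZero L)
    OthersZero? L = FinP.all? (λ i → ¬? (i FinP.≟ j) →-dec (dig L (X i) ≟ 0))

    others : ℕ → ℕ
    others L = sumVec k (updateAt (λ i → dig L (X i)) j (const 0))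

    others-zero : ∀ L → OthersZero L → others L ≡ 0
    others-zero L zeros = sumVec-zero k _ zero-term
      where zero-term : ∀ i → updateAt (λ i → dig L (X i)) j (const 0) i ≡ 0
            zero-term i with i FinP.≟ j
            ... | yes refl = updateAt-updates j _
            ... | no i≢j = trans (updateAt-minimal i j _ i≢j) (zeros i i≢j)

    Open : ℕ → Set
    Open L = (dig L v ≢ β L ∸ 1) ⊎ ¬ OthersZero L

    Open? : ∀ L → Dec (Open L)
    Open? L = ¬? (dig L v ≟ β L ∸ 1) ⊎-dec ¬? (OthersZero? L)

    closed-v : ∀ L → ¬ Open L → dig L v ≡ β L ∸ 1
    closed-v L closed = decidable-stable (dig L v ≟ β L ∸ 1) (closed ∘ inj₁)

    closed-others : ∀ L → ¬ Open L → OthersZero L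
    closed-others L closed = decidable-stable (OthersZero? L) (closed ∘ inj₂)

    β-1+1 : ∀ L → 1 + (β L ∸ 1) ≡ β L
    β-1+1 L = m+[n∸m]≡n (β-pos L)

    -- Case A: μ < ℓ is the lowest open position.  Coordinate j gets the low
    -- part w whose digits make φ(Y) = v below ℓ; then mord Y = μ.
    module OpenCase (μ : ℕ) (μ<ℓ : μ < ℓ) (open-μ : Open μ) (closed-below : ∀ L → L < μ → ¬ Open L) where

      -- The shift of φ at digit L is (β_L − 1)·carry L.
      carry : ℕ → ℕ
      carry L with L ≤? μ
      ... | yes _ = 1
      ... | no _ = 0

      carry-≤ : ∀ L → L ≤ μ → carry L ≡ 1
      carry-≤ L L≤μ with L ≤? μ
      ... | yes _ = refl
      ... | no L≰μ = ⊥-elim (L≰μ L≤μ)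

      carry-> : ∀ L → ¬ L ≤ μ → carry L ≡ 0
      carry-> L L≰μ with L ≤? μ
      ... | yes L≤μ = ⊥-elim (L≰μ L≤μ)
      ... | no _ = refl

      wdigit : ℕ → ℕ
      wdigit L = (dig L v + carry L + (β L ∸ 1) * others L) % β L

      w : ℕ
      w = expansion ℓ wdigit

      w<B : w < B β ℓ
      w<B = expansion<B ℓ wdigit (λ L → m%n<n _ (β L))

      lo' : Fin k → ℕ
      lo' = updateAt lo j (const w)

      lo'<B : ∀ i → lo' i < B β ℓ
      lo'<B i with i FinP.≟ j
      ... | yes refl = subst (_< B β ℓ) (sym (updateAt-updates j lo)) w<B
      ... | no i≢j = subst (_< B β ℓ) (sym (updateAt-minimal i j lo i≢j)) (lowPart<B (X i) ℓ)

      Y : Fin k → ℕ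
      Y i = compose ℓ (lo' i) (e i) (H i)

      Y-digit-other : ∀ i → i ≢ j → ∀ L → L < ℓ → dig L (Y i) ≡ dig L (X i)
      Y-digit-other i i≢j L lt = trans (compose-digit-below ℓ (lo' i) (e i) (H i) L lt)
        (trans (cong (dig L) (updateAt-minimal i j lo i≢j)) (lowPart-digit (X i) ℓ L lt))

      Y-digit-j : ∀ L → L < ℓ → dig L (Y j) ≡ wdigit L
      Y-digit-j L lt = trans (compose-digit-below ℓ (lo' j) (e j) (H j) L lt)
        (trans (cong (dig L) (updateAt-updates j lo))
               (expansion-digit ℓ wdigit (λ L → m%n<n _ (β L)) L lt))

      Y-digit-ℓ : ∀ i → dig ℓ (Y i) ≡ e i
      Y-digit-ℓ i = compose-digit-at ℓ (lo' i) (e i) (H i) (lo'<B i) (e<β i)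

      Y-digit-above : ∀ i L → ℓ < L → dig L (Y i) ≡ dig L (X i)
      Y-digit-above i L ℓ<L = compose-digit-above ℓ (lo' i) (e i) (X i) L (lo'<B i) (e<β i) ℓ<L

      Y-digitSum-below : ∀ L → L < ℓ → digitSum L k Y ≡ wdigit L + others L
      Y-digitSum-below L lt = trans (sumVec-split k j (λ i → dig L (Y i)))
        (cong₂ _+_ (Y-digit-j L lt)
          (sumVec-cong k _ _ (updateAt-cong j _ _ refl (λ i i≢j → Y-digit-other i i≢j L lt))))

      Y-low-zero : LowZero Y μ
      Y-low-zero i L L<μ with i FinP.≟ j
      ... | no i≢j = trans (Y-digit-other i i≢j L (<-trans L<μ μ<ℓ)) (closed-others L (closed-below L L<μ) i i≢j)
      ... | yes refl = trans (Y-digit-j L (<-trans L<μ μ<ℓ)) (begin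
          (dig L v + carry L + (β L ∸ 1) * others L) % β L
        ≡⟨ cong₂ (λ x y → (x + carry L + (β L ∸ 1) * y) % β L)
                 (closed-v L (closed-below L L<μ)) (others-zero L (closed-others L (closed-below L L<μ))) ⟩
          ((β L ∸ 1) + carry L + (β L ∸ 1) * 0) % β L
        ≡⟨ cong (λ c → ((β L ∸ 1) + c + (β L ∸ 1) * 0) % β L) (carry-≤ L (<⇒≤ L<μ)) ⟩
          ((β L ∸ 1) + 1 + (β L ∸ 1) * 0) % β L
        ≡⟨ cong (_% β L) (trans (cong ((β L ∸ 1) + 1 +_) (*-zeroʳ (β L ∸ 1)))
                          (trans (+-identityʳ _) (trans (+-comm _ 1) (β-1+1 L)))) ⟩
          β L % β L
        ≡⟨ n%n≡0 (β L) ⟩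
          0
        ∎)
        where open ≡-Reasoning

      Y-nonzero-at-μ : ∃ λ i → dig μ (Y i) ≢ 0
      Y-nonzero-at-μ with OthersZero? μ
      ... | no ¬zeros =
        let (i , ¬i) = FinP.¬∀⟶∃¬ k _ (λ i → ¬? (i FinP.≟ j) →-dec (dig μ (X i) ≟ 0)) ¬zeros
            i≢j : i ≢ j
            i≢j i≡j = ¬i (λ i≢j → ⊥-elim (i≢j i≡j))
        in i , λ z → ¬i (λ _ → trans (sym (Y-digit-other i i≢j μ μ<ℓ)) z)
      ... | yes zeros = j , λ z → 0≢1+n (trans (sym z) (trans (Y-digit-j μ μ<ℓ) wdigit-μ))
        where
          vμ≢max : dig μ v ≢ β μ ∸ 1
          vμ≢max = [ (λ ne → ne) , (λ ¬zeros → ⊥-elim (¬zeros zeros)) ]′ open-μ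
          wdigit-μ : wdigit μ ≡ suc (dig μ v)
          wdigit-μ = trans (cong₂ (λ c o → (dig μ v + c + (β μ ∸ 1) * o) % β μ) (carry-≤ μ ≤-refl) (others-zero μ zeros))
            (trans (cong (_% β μ) (trans (cong (dig μ v + 1 +_) (*-zeroʳ (β μ ∸ 1)))
                                         (trans (+-identityʳ _) (+-comm (dig μ v) 1))))
              (m<n⇒m%n≡m (suc-<-if-≢pred _ _ (dig<β μ v) vμ≢max)))

      mordY : mord β k Y ≡ just μ
      mordY = mord-intro k Y μ (Y-low-zero , Y-nonzero-at-μ)

      -- Below ℓ the digit sum of Y is wdigit L + others L, which carry turns into v_L.
      φY-digit-below : ∀ L → L < ℓ → dig L (φ β k Y) ≡ dig L v
      φY-digit-below L L<ℓ = begin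
          dig L (φ β k Y)
        ≡⟨ shifted (L ≤? μ) ⟩
          (digitSum L k Y + p * carry L) % β L
        ≡⟨ cong (λ s → (s + p * carry L) % β L) (Y-digitSum-below L L<ℓ) ⟩
          ((dig L v + carry L + p * others L) % β L + others L + p * carry L) % β L
        ≡⟨ cong (_% β L) (+-assoc _ (others L) (p * carry L)) ⟩
          ((dig L v + carry L + p * others L) % β L + (others L + p * carry L)) % β L
        ≡⟨ %-absorbˡ _ _ (β L) ⟩
          (dig L v + carry L + p * others L + (others L + p * carry L)) % β L
        ≡⟨ cong (_% β L) (regroup (dig L v) (carry L) (others L) p) ⟩
          (dig L v + (1 + p) * (carry L + others L)) % β L
        ≡⟨ cong (λ b → (dig L v + b * (carry L + others L)) % β L) (β-1+1 L) ⟩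
          (dig L v + β L * (carry L + others L)) % β L
        ≡⟨ digit-residue (β L) (dig L v) _ (dig<β L v) ⟩
          dig L v
        ∎
        where
          open ≡-Reasoning
          p : ℕ
          p = β L ∸ 1
          regroup : ∀ x c o p → x + c + p * o + (o + p * c) ≡ x + (1 + p) * (c + o)
          regroup = solve-∀
          shifted : Dec (L ≤ μ) → dig L (φ β k Y) ≡ (digitSum L k Y + p * carry L) % β L
          shifted (yes L≤μ) = trans (φ-digit-≤ k Y mordY L L≤μ)
            (cong (λ c → (digitSum L k Y + c) % β L) (sym (trans (cong (p *_) (carry-≤ L L≤μ)) (*-identityʳ p))))
          shifted (no L≰μ) = trans (φ-digit-> k Y mordY L (≰⇒> L≰μ))
            (cong (_% β L) (sym (trans (cong (λ c → digitSum L k Y + p * c) (carry-> L L≰μ))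
                                       (trans (cong (digitSum L k Y +_) (*-zeroʳ p)) (+-identityʳ _)))))

      φY≡v : φ β k Y ≡ v
      φY≡v = digits-ext _ _ by-position
        where
          by-position : ∀ L → dig L (φ β k Y) ≡ dig L v
          by-position L with <-cmp L ℓ
          ... | tri< L<ℓ _ _ = φY-digit-below L L<ℓ
          ... | tri> _ _ ℓ<L = φ-agrees-above Y mordY (<⇒≤ μ<ℓ) Y-digit-above L ℓ<L
          ... | tri≈ _ refl _ = trans (φ-digit-> k Y mordY L μ<ℓ)
            (trans (cong (_% β L) (trans (sumVec-cong k _ _ Y-digit-ℓ) Σe≡vℓ)) (m<n⇒m%n≡m (dig<β L v)))

      Y≤X : ∀ i → Y i ≤ X i
      Y≤X i with i FinP.≟ j
      ... | yes refl = subst (Y i ≤_) (sym (X≡compose i))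
            (<⇒≤ (compose-< ℓ (lo' i) (lo i) (e i) (a i) (H i) (lo'<B i) ej<aj))
      ... | no i≢j = subst (Y i ≤_) (sym (X≡compose i))
            (subst (λ z → compose ℓ z (e i) (H i) ≤ compose ℓ (lo i) (a i) (H i)) (sym (updateAt-minimal i j lo i≢j))
              (compose-≤ ℓ (lo i) (lo i) (e i) (a i) (H i) ≤-refl (e≤a i)))

      C : Fin k → ℕ
      C i = X i ∸ Y i

      C-aligned : ∀ i → lo' i ≡ lo i → C i ≡ B β ℓ * (a i ∸ e i)
      C-aligned i same-low = trans (cong₂ _∸_ (X≡compose i) (cong (λ z → compose ℓ z (e i) (H i)) same-low))
        (trans (compose-∸ ℓ (lo i) (lo i) (e i) (a i) (H i) ≤-refl (e≤a i))
          (cong (_+ B β ℓ * (a i ∸ e i)) (n∸n≡0 (lo i))))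

      -- If w = lo_j the move is aligned at ℓ (and v-residue makes it
      -- nonzero mod β_ℓ); otherwise only C_j has nonzero digits below ℓ.
      move-is-cord : Cord β k C
      move-is-cord with w ≟ lo j
      ... | yes w≡lo = cord-aligned k C ℓ (λ i → a i ∸ e i) (λ i → C-aligned i (lo'≡lo i))
                                    (λ i → ≤-<-trans (m∸n≤m (a i) (e i)) (dig<β ℓ (X i))) Σδ≢0
        where
          lo'≡lo : ∀ i → lo' i ≡ lo i
          lo'≡lo i with i FinP.≟ j
          ... | yes refl = trans (updateAt-updates j lo) w≡lo
          ... | no i≢j = updateAt-minimal i j lo i≢j
          Σδ≢0 : sumVec k (λ i → a i ∸ e i) % β ℓ ≢ 0
          Σδ≢0 z = [ (λ vℓ≢s → remainder-nonzero e vℓ e≤a Σe≡vℓ (dig<β ℓ v) vℓ≢s z)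
                   , (λ X-low-zero → let (i , nz) = Y-nonzero-at-μ in
                        nz (trans (compose-digit-below ℓ (lo' i) (e i) (H i) μ μ<ℓ)
                             (trans (cong (dig μ) (lo'≡lo i))
                               (trans (lowPart-digit (X i) ℓ μ μ<ℓ) (X-low-zero i μ μ<ℓ)))))
                   ]′ v-residue
      ... | no w≢lo = cord-one-low k C ℓ j others-low Cj-not-low
        where
          others-low : ∀ i → i ≢ j → ∀ L → L < ℓ → dig L (C i) ≡ 0
          others-low i i≢j L lt =
            trans (cong (dig L) (C-aligned i (updateAt-minimal i j lo i≢j))) (dig-below-multiple-0 ℓ L lt _)
          -- Otherwise X_j and Y_j, hence lo_j and w, share their digits below ℓ.
          Cj-not-low : ¬ (∀ L → L < ℓ → dig L (C j) ≡ 0)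
          Cj-not-low Cj-low = w≢lo (digits-ext-below ℓ w (lo j) w<B (lowPart<B (X j) ℓ) same-digits)
            where
              Xj≡Yj+BQ : X j ≡ Y j + B β ℓ * (C j /B ℓ)
              Xj≡Yj+BQ = trans (sym (m+[n∸m]≡n (Y≤X j))) (cong (Y j +_) (low-zero⇒multiple ℓ (C j) Cj-low))
              same-digits : ∀ L → L < ℓ → dig L w ≡ dig L (lo j)
              same-digits L lt = begin
                  dig L w
                ≡⟨ cong (dig L) (sym (updateAt-updates j lo)) ⟩
                  dig L (lo' j)
                ≡⟨ sym (compose-digit-below ℓ (lo' j) (e j) (H j) L lt) ⟩
                  dig L (Y j)
                ≡⟨ sym (dig-below-multiple ℓ L lt (Y j) _) ⟩
                  dig L (Y j + B β ℓ * (C j /B ℓ))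
                ≡⟨ cong (dig L) (sym Xj≡Yj+BQ) ⟩
                  dig L (X j)
                ≡⟨ sym (lowPart-digit (X j) ℓ L lt) ⟩
                  dig L (lo j)
                ∎
                where open ≡-Reasoning

      option : ∃ λ Y → CordOption k X Y × φ β k Y ≡ v
      option = Y , (X≢0 , mord-nonzero k Y mordY , Y≤X , move-is-cord) , φY≡v

    -- Case B: every position below ℓ is closed, so v has maximal digits below
    -- ℓ.  Then Y has zero low part and digits e' ≤ a at ℓ with Σe' = vℓ + 1;
    -- now mord Y = ℓ and the shift β_ℓ − 1 brings digit ℓ of φ(Y) back to vℓ.
    module ClosedCase (closed : ∀ L → L < ℓ → ¬ Open L) where

      v-max : ∀ L → L < ℓ → dig L v ≡ β L ∸ 1
      v-max L lt = closed-v L (closed L lt)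

      carry-room : (suc vℓ < β ℓ) × (suc vℓ ≤ sℓ) × ((suc vℓ ≢ sℓ % β ℓ) ⊎ ¬ LowZero X ℓ)
      carry-room = v-carry v-max
      raised : ∃ λ e → (∀ i → e i ≤ a i) × sumVec k e ≡ suc vℓ
      raised = sumVec-below k a (suc vℓ) (proj₁ (proj₂ carry-room))

      e' : Fin k → ℕ
      e' = proj₁ raised
      e'≤a : ∀ i → e' i ≤ a i
      e'≤a = proj₁ (proj₂ raised)
      Σe'≡1+vℓ : sumVec k e' ≡ suc vℓ
      Σe'≡1+vℓ = proj₂ (proj₂ raised)
      e'<β : ∀ i → e' i < β ℓ
      e'<β i = ≤-<-trans (e'≤a i) (dig<β ℓ (X i))

      Y : Fin k → ℕ
      Y i = compose ℓ 0 (e' i) (H i)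

      Y-low-zero : LowZero Y ℓ
      Y-low-zero i L lt = trans (compose-digit-below ℓ 0 (e' i) (H i) L lt) (dig-0 L)

      Y-digit-ℓ : ∀ i → dig ℓ (Y i) ≡ e' i
      Y-digit-ℓ i = compose-digit-at ℓ 0 (e' i) (H i) (B-pos ℓ) (e'<β i)

      Y-digit-above : ∀ i L → ℓ < L → dig L (Y i) ≡ dig L (X i)
      Y-digit-above i L lt = compose-digit-above ℓ 0 (e' i) (X i) L (B-pos ℓ) (e'<β i) lt

      mordY : mord β k Y ≡ just ℓ
      mordY = mord-intro k Y ℓ (Y-low-zero , i , λ z → e'i≢0 (trans (sym (Y-digit-ℓ i)) z))
        where
          nonzero : ∃ λ i → e' i ≢ 0
          nonzero = nonzero-term k e' (λ z → 0≢1+n (trans (sym z) Σe'≡1+vℓ))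
          i : Fin k
          i = proj₁ nonzero
          e'i≢0 : e' i ≢ 0
          e'i≢0 = proj₂ nonzero

      φY≡v : φ β k Y ≡ v
      φY≡v = digits-ext _ _ by-position
        where
          by-position : ∀ L → dig L (φ β k Y) ≡ dig L v
          by-position L with <-cmp L ℓ
          ... | tri< L<ℓ _ _ = trans (φ-digit-< k Y mordY L L<ℓ) (sym (v-max L L<ℓ))
          ... | tri> _ _ ℓ<L = φ-agrees-above Y mordY ≤-refl Y-digit-above L ℓ<L
          ... | tri≈ _ refl _ = begin
              dig L (φ β k Y)
            ≡⟨ φ-digit-≤ k Y mordY L ≤-refl ⟩
              (digitSum L k Y + (β L ∸ 1)) % β L
            ≡⟨ cong (λ s → (s + (β L ∸ 1)) % β L) (trans (sumVec-cong k _ _ Y-digit-ℓ) Σe'≡1+vℓ) ⟩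
              (suc vℓ + (β L ∸ 1)) % β L
            ≡⟨ cong (_% β L) (trans (regroup vℓ (β L ∸ 1)) (cong (λ b → vℓ + b * 1) (β-1+1 L))) ⟩
              (vℓ + β L * 1) % β L
            ≡⟨ digit-residue (β L) vℓ 1 (dig<β L v) ⟩
              vℓ
            ∎
            where
              open ≡-Reasoning
              regroup : ∀ x p → suc x + p ≡ x + (1 + p) * 1
              regroup = solve-∀

      Y≤X : ∀ i → Y i ≤ X i
      Y≤X i = subst (Y i ≤_) (sym (X≡compose i)) (compose-≤ ℓ 0 (lo i) (e' i) (a i) (H i) z≤n (e'≤a i))

      C : Fin k → ℕ
      C i = X i ∸ Y i

      C≡lo+B : ∀ i → C i ≡ lo i + B β ℓ * (a i ∸ e' i)
      C≡lo+B i = trans (cong (_∸ Y i) (X≡compose i)) (compose-∸ ℓ 0 (lo i) (e' i) (a i) (H i) z≤n (e'≤a i))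

      C-digit-below : ∀ i L → L < ℓ → dig L (C i) ≡ dig L (X i)
      C-digit-below i L lt =
        trans (cong (dig L) (C≡lo+B i)) (trans (dig-below-multiple ℓ L lt _ _) (lowPart-digit (X i) ℓ L lt))

      -- If X_j has a nonzero digit below ℓ, C_j is the only coordinate that
      -- does; otherwise X vanishes below ℓ and the move is aligned at ℓ.
      move-is-cord : Cord β k C
      move-is-cord with least-below (λ L → dig L (X j) ≢ 0) (λ L → ¬? (dig L (X j) ≟ 0)) ℓ
      ... | inj₂ (r , r<ℓ , nz , _) =
        cord-one-low k C ℓ j (λ i i≢j L lt → trans (C-digit-below i L lt) (closed-others L (closed L lt) i i≢j))
                             (λ Cj-low → nz (trans (sym (C-digit-below j r r<ℓ)) (Cj-low r r<ℓ)))
      ... | inj₁ none = cord-aligned k C ℓ (λ i → a i ∸ e' i) C≡Bδ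
                          (λ i → ≤-<-trans (m∸n≤m (a i) (e' i)) (dig<β ℓ (X i))) Σδ≢0
        where
          X-low-zero : LowZero X ℓ
          X-low-zero i L lt with i FinP.≟ j
          ... | yes refl = decidable-stable (dig L (X i) ≟ 0) (none L lt)
          ... | no i≢j = closed-others L (closed L lt) i i≢j
          lo≡0 : ∀ i → lo i ≡ 0
          lo≡0 i = digits-ext-below ℓ (lo i) 0 (lowPart<B (X i) ℓ) (B-pos ℓ)
            (λ L lt → trans (lowPart-digit (X i) ℓ L lt) (trans (X-low-zero i L lt) (sym (dig-0 L))))
          C≡Bδ : ∀ i → C i ≡ B β ℓ * (a i ∸ e' i)
          C≡Bδ i = trans (C≡lo+B i) (cong (_+ B β ℓ * (a i ∸ e' i)) (lo≡0 i))
          Σδ≢0 : sumVec k (λ i → a i ∸ e' i) % β ℓ ≢ 0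
          Σδ≢0 z = [ (λ ne → remainder-nonzero e' (suc vℓ) e'≤a Σe'≡1+vℓ (proj₁ carry-room) ne z)
                   , (λ ¬low → ¬low X-low-zero) ]′ (proj₂ (proj₂ carry-room))

      option : ∃ λ Y → CordOption k X Y × φ β k Y ≡ v
      option = Y , (X≢0 , mord-nonzero k Y mordY , Y≤X , move-is-cord) , φY≡v

    option : ∃ λ Y → CordOption k X Y × φ β k Y ≡ v
    option with least-below Open Open? ℓ
    ... | inj₂ (μ , μ<ℓ , open-μ , closed-below) = OpenCase.option μ μ<ℓ open-μ closed-below
    ... | inj₁ closed = ClosedCase.option closed

  digitSum-at-mord : ∀ k X {m} → mord β k X ≡ just m → 1 ≤ digitSum m k X
  digitSum-at-mord k X eq =
    let (i , nz) = proj₂ (mord-just k X eq) in ≤-trans (n≢0⇒n>0 nz) (term≤sumVec k _ i)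

  -- Half (2), split according to the position of the highest digit t where
  -- v < φ(X) differ relative to m = mord X; the construction runs at
  -- ℓ = max(t, m).
  module _ (k : ℕ) (X : Fin k → ℕ) (X≢0 : Pmis k X) {m : ℕ} (mordX : mord β k X ≡ just m)
           (v t : ℕ) (v<φ-at-t : dig t v < dig t (φ β k X))
           (agree : ∀ L → t < L → dig L v ≡ dig L (φ β k X)) where

    -- t > m: digit t of φ(X) is s_t mod β_t, and X does not vanish below t.
    reach-above-mord : m < t → ∃ λ Y → CordOption k X Y × φ β k Y ≡ v
    reach-above-mord m<t =
      Construction.option k X X≢0 mordX t (<⇒≤ m<t) v agree (<-≤-trans vt<s%β (m%n≤m _ (β t)))
        (inj₁ (λ eq → <-irrefl eq vt<s%β))
        (λ _ → ≤-<-trans vt<s%β (m%n<n _ (β t)) , ≤-trans vt<s%β (m%n≤m _ (β t))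
             , inj₂ (λ X-low-zero → let (i , nz) = proj₂ (mord-just k X mordX) in nz (X-low-zero i m m<t)))
      where
        vt<s%β : dig t v < digitSum t k X % β t
        vt<s%β = subst (dig t v <_) (φ-digit-> k X mordX t m<t) v<φ-at-t

    -- t = m: digit m of φ(X) is the residue of s_m − 1.
    reach-at-mord : m ≡ t → ∃ λ Y → CordOption k X Y × φ β k Y ≡ v
    reach-at-mord refl =
      Construction.option k X X≢0 mordX m ≤-refl v agree vm<s (inj₂ (≤mord⇒LowZero k X m mordX ≤-refl))
        (λ _ → proj₁ (proj₂ room) , proj₁ (proj₂ (proj₂ room)) , inj₁ (proj₂ (proj₂ (proj₂ room))))
      where
        room : (dig m v < digitSum m k X) × (suc (dig m v) < β m) × (suc (dig m v) ≤ digitSum m k X)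
               × (suc (dig m v) ≢ digitSum m k X % β m)
        room = below-predResidue (β m) (digitSum m k X) (dig m v) (digitSum-at-mord k X mordX)
                 (subst (dig m v <_) (φ-digit-≤ k X mordX m ≤-refl) v<φ-at-t)
        vm<s : dig m v < digitSum m k X
        vm<s = proj₁ room

    -- t < m: v agrees with φ(X) at m, and v cannot end in maximal digits
    -- below m since φ(X) does and v_t < φ(X)_t.
    reach-below-mord : t < m → ∃ λ Y → CordOption k X Y × φ β k Y ≡ v
    reach-below-mord t<m =
      Construction.option k X X≢0 mordX m ≤-refl v (λ L m<L → agree L (<-trans t<m m<L)) vm<s
        (inj₂ (≤mord⇒LowZero k X m mordX ≤-refl)) no-carry
      where
        vm<s : dig m v < digitSum m k X
        vm<s = subst (_< digitSum m k X) (sym (trans (agree m t<m) (φ-digit-≤ k X mordX m ≤-refl)))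
                     (proj₁ (predResidue (β m) _ (digitSum-at-mord k X mordX)))
        no-carry : (∀ L → L < m → dig L v ≡ β L ∸ 1) →
                   (suc (dig m v) < β m) × (suc (dig m v) ≤ digitSum m k X)
                   × ((suc (dig m v) ≢ digitSum m k X % β m) ⊎ ¬ LowZero X m)
        no-carry v-max = ⊥-elim (<-irrefl refl
          (subst (_< β t ∸ 1) (v-max t t<m) (subst (dig t v <_) (φ-digit-< k X mordX t t<m) v<φ-at-t)))

  φ-reaches : ∀ k X → Pmis k X → ∀ v → v < φ β k X → ∃ λ Y → CordOption k X Y × φ β k Y ≡ v
  φ-reaches k X X≢0 v v<φ = by-comparison (<-cmp m t)
    where
      difference : ∃ λ t → dig t v < dig t (φ β k X) × (∀ L → t < L → dig L v ≡ dig L (φ β k X))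
      difference = highest-difference v (φ β k X) v<φ
      t m : ℕ
      t = proj₁ difference
      m = proj₁ (mord-defined k X X≢0)
      mordX : mord β k X ≡ just m
      mordX = proj₂ (mord-defined k X X≢0)
      v<φ-at-t : dig t v < dig t (φ β k X)
      v<φ-at-t = proj₁ (proj₂ difference)
      agree : ∀ L → t < L → dig L v ≡ dig L (φ β k X)
      agree = proj₂ (proj₂ difference)
      by-comparison : Tri (m < t) (m ≡ t) (t < m) → ∃ λ Y → CordOption k X Y × φ β k Y ≡ v
      by-comparison (tri< m<t _ _) = reach-above-mord k X X≢0 mordX v t v<φ-at-t agree m<t
      by-comparison (tri≈ _ m≡t _) = reach-at-mord k X X≢0 mordX v t v<φ-at-t agree m≡t
      by-comparison (tri> _ _ t<m) = reach-below-mord k X X≢0 mordX v t v<φ-at-t agree t<m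

  φ-isSG : ∀ k → IsSG k (Pmis k) (Cord β k) (φ β k)
  φ-isSG k X X≢0 = (λ Y option → φ-changes k X Y option) , φ-reaches k X X≢0

theorem1 : (β : ℕ → ℕ) → (∀ L → 2 ≤ β L) → (k : ℕ) → 1 ≤ k
    → (C : (Fin k → ℕ) → Set) → (∀ c → C c → NonZeroV k c)
    → Saturated β k (Pmis k) C
    → ∀ g → IsSG k (Pmis k) C g
    → ∀ X → Pmis k X → g X ≡ φ β k X
theorem1 β β≥2 k _ C _ saturated g g-isSG X X≢0 =
  saturated g (φ β k) g-isSG (OrdGame.φ-isSG β β≥2 k) X X≢0
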